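{- Let $\omega\in\mathbb C$ with $\omega^2\neq1$ and let $n\geq0$ be an integer. There exists a basis of the $\mathfrak K_\omega$-module $L_n$ with respect to which $A$ is represented by $\mathrm{diag}(\theta_0,\dots,\theta_n)$; $B$ is represented by the tridiagonal matrix with diagonal entries $\alpha_0,\dots,\alpha_n$, entries $(i+1,i)$ equal to $\beta_i$ ($0\le i\le n-1$) and entries $(i-1,i)$ equal to $\gamma_i$ ($1\le i\le n$); and $C$ is represented by the tridiagonal matrix with zero diagonal, entries $(i+1,i)$ equal to $-\beta_i$ and entries $(i-1,i)$ equal to $\gamma_i$. Here $\alpha_i=\frac{(2i-n)\omega}{2}$, $\beta_i=\frac{(i+1)(1-\omega)}{2}$, $\gamma_i=\frac{(n-i+1)(1+\omega)}{2}$, $\theta_i=\frac n2-i$.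
   Context: All algebras are unital associative over $\mathbb C$ and $[x,y]=xy-yx$. $\mathrm U(\mathfrak{sl}_2)$ is the algebra generated by $E,F,H$ with $[H,E]=2E$, $[H,F]=-2F$, $[E,F]=H$. For $\omega\in\mathbb C$, $\mathfrak K_\omega$ is the algebra generated by $A,B$ subject to $A^2B-2ABA+BA^2=B+\omega A$ and $B^2A-2BAB+AB^2=A+\omega B$, and $C=[A,B]$. There is an algebra homomorphism $\zeta\colon\mathfrak K_\omega\to\mathrm U(\mathfrak{sl}_2)$ with $A\mapsto \frac{1+\omega}{2}E+\frac{1-\omega}{2}F-\frac{\omega}{2}H$, $B\mapsto \frac12H$. For $n\ge0$, $L_n$ is the $(n+1)$-dimensional $\mathrm U(\mathfrak{sl}_2)$-module with basis $v_0,\dots,v_n$ where $Ev_i=(n-i+1)v_{i-1}$ ($1\le i\le n$), $Ev_0=0$, $Fv_i=(i+1)v_{i+1}$ ($0\le i\le n-1$), $Fv_n=0$, $Hv_i=(n-2i)v_i$; it is regarded as a $\mathfrak K_\omega$-module by pulling back via $\zeta$. -}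

module Defs where

open import Level using (Level; _⊔_)
open import Data.Nat using (ℕ; zero; suc; _∸_; _≟_) renaming (_*_ to _*ℕ_; _+_ to _+ℕ_)
open import Data.Fin using (Fin; toℕ) renaming (zero to fz; suc to fs)
open import Data.Product using (Σ; _×_)
open import Relation.Nullary using (¬_; yes; no)
open import Relation.Binary.PropositionalEquality using (_≡_)
open import Algebra.Bundles using (CommutativeRing)

module Over {c ℓ : Level} (R : CommutativeRing c ℓ) where
  open CommutativeRing R

  ι : ℕ → Carrier
  ι zero = 0#
  ι (suc m) = 1# + ι m

  -- R is a field of characteristic zero (inv is a total inverse,
  -- only required to be an inverse on nonzero elements)
  record IsCharZeroField : Set (c ⊔ ℓ) where
    field
      inv      : Carrier → Carrier
      inv-r    : ∀ x → ¬ (x ≈ 0#) → x * inv x ≈ 1#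
      charZero : ∀ m → ¬ (ι (suc m) ≈ 0#)

  sumF : ∀ {k} → (Fin k → Carrier) → Carrier
  sumF {zero} f = 0#
  sumF {suc k} f = f fz + sumF (λ i → f (fs i))

  Vect : ℕ → Set c
  Vect k = Fin k → Carrier

  Mat : ℕ → Set c
  Mat k = Fin k → Fin k → Carrier

  act : ∀ {k} → Mat k → Vect k → Vect k
  act M x i = sumF (λ j → M i j * x j)

  lincomb : ∀ {k} → Vect k → (Fin k → Vect k) → Vect k
  lincomb a u i = sumF (λ j → a j * u j i)

  _≋_ : ∀ {k} → Vect k → Vect k → Set ℓ
  x ≋ y = ∀ i → x i ≈ y i

  IsBasis : ∀ {k} → (Fin k → Vect k) → Set (c ⊔ ℓ)
  IsBasis {k} u =
    (∀ (a : Vect k) → lincomb a u ≋ (λ _ → 0#) → ∀ j → a j ≈ 0#) ×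
    (∀ (x : Vect k) → Σ (Vect k) (λ a → lincomb a u ≋ x))

  -- the linear operator f is represented by the matrix M w.r.t. basis u:
  -- f (u j) = Σ_i M i j u i   (column j = coordinates of f (u j))
  Represents : ∀ {k} → (Fin k → Vect k) → (Vect k → Vect k) → Mat k → Set ℓ
  Represents u f M = ∀ j → f (u j) ≋ lincomb (λ i → M i j) u

  module Field (F : IsCharZeroField) where
    open IsCharZeroField F

    half : Carrier
    half = inv (1# + 1#)

    module Module (n : ℕ) where
      -- L_n in the basis v_0..v_n (coordinates), matrices of E, F, H:
      -- E v_j = (n-j+1) v_{j-1},  F v_j = (j+1) v_{j+1},  H v_j = (n-2j) v_j
      Emat : Mat (suc n)
      Emat i j with toℕ j ≟ suc (toℕ i)
      ... | yes _ = ι (suc (n ∸ toℕ j))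
      ... | no _  = 0#

      Fmat : Mat (suc n)
      Fmat i j with toℕ i ≟ suc (toℕ j)
      ... | yes _ = ι (suc (toℕ j))
      ... | no _  = 0#

      Hmat : Mat (suc n)
      Hmat i j with toℕ i ≟ toℕ j
      ... | yes _ = ι n - ι (2 *ℕ toℕ j)
      ... | no _  = 0#

      module Zeta (ω : Carrier) where
        -- ζ(A) = (1+ω)/2 E + (1-ω)/2 F - ω/2 H ,  ζ(B) = H/2
        Aop : Vect (suc n) → Vect (suc n)
        Aop x i = half * (1# + ω) * act Emat x i
                + half * (1# - ω) * act Fmat x i
                - half * ω * act Hmat x i

        Bop : Vect (suc n) → Vect (suc n)
        Bop x i = half * act Hmat x i

        Cop : Vect (suc n) → Vect (suc n)
        Cop x i = Aop (Bop x) i - Bop (Aop x) i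

        θ α β γ : ℕ → Carrier
        θ i = half * ι n - ι i
        α i = half * ((ι (2 *ℕ i) - ι n) * ω)
        β i = half * (ι (suc i) * (1# - ω))
        γ i = half * (ι (suc (n ∸ i)) * (1# + ω))

        DA : Mat (suc n)
        DA i j with toℕ i ≟ toℕ j
        ... | yes _ = θ (toℕ j)
        ... | no _  = 0#

        TB : Mat (suc n)
        TB i j with toℕ i ≟ toℕ j | toℕ i ≟ suc (toℕ j) | suc (toℕ i) ≟ toℕ j
        ... | yes _ | _     | _     = α (toℕ j)
        ... | no _  | yes _ | _     = β (toℕ j)
        ... | no _  | no _  | yes _ = γ (toℕ j)
        ... | no _  | no _  | no _  = 0#

        TC : Mat (suc n)
        TC i j with toℕ i ≟ suc (toℕ j) | suc (toℕ i) ≟ toℕ j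
        ... | yes _ | _     = - β (toℕ j)
        ... | no _  | yes _ = γ (toℕ j)
        ... | no _  | no _  = 0#

{-# OPTIONS --safe #-}
-- Realise L_n as the binary forms of degree n in x and y, with vᵢ = (n choose i) xⁿ⁻ⁱ yⁱ;
-- then every element of sl₂ acts as the derivation attached to its 2 × 2 matrix.
-- The matrices of ζ(A) and ζ(B) are exchanged by conjugation with S = (1−ω 1−ω; 1+ω −(1−ω)),
-- which is invertible as S² = 2(1 − ω) and ω ≠ 1. Substituting (x, y) ↦ S(x, y) in forms is
-- therefore an invertible map G on L_n with A G = G B and B G = G A, so in the basis uᵢ = G vᵢ
-- the operator A has the matrix of B in the basis v, which is diag(θ), and B has the matrix of A,
-- which is the tridiagonal one; C = AB − BA then has entries (θᵢ − θⱼ) times those of B.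
module Submission where

open import Level using (Level)
open import Data.Nat as ℕ using (ℕ; zero; suc; _<_; _≤_; s≤s; z≤n; _∸_; _≟_)
open import Data.Fin using (Fin; toℕ) renaming (zero to fz; suc to fs)
import Data.Fin.Properties as Fin
open import Data.Empty using (⊥-elim)
open import Data.Product using (Σ; _,_; _×_)
open import Data.Integer as ℤ using (ℤ; +_; -[1+_])
import Data.Integer.Properties as ℤ
import Data.Nat.Properties as ℕ
open import Data.Sign as Sign using ()
open import Data.Maybe using (Maybe; just; nothing)
open import Relation.Nullary using (¬_; yes; no)
open import Data.Sum using (inj₁; inj₂)
open import Relation.Binary.PropositionalEquality as ≡ using (_≡_; _≢_)
open import Algebra.Bundles using (CommutativeRing)
import Algebra.Properties.Ring as RingProperties
import Algebra.Properties.AbelianGroup as AbelianGroupProperties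
import Algebra.Solver.Ring
import Algebra.Properties.Semiring.Mult.TCOptimised as MultiplesProperties
open import Algebra.Solver.Ring.AlmostCommutativeRing
  using (AlmostCommutativeRing; fromCommutativeRing; _-Raw-AlmostCommutative⟶_)
open import Defs

module IntegerCoefficientSolver {c ℓ : Level} (R : CommutativeRing c ℓ) where
  open CommutativeRing R
  open RingProperties ring using (-‿distribˡ-*; -‿distribʳ-*; -‿involutive; -0#≈0#)
  open AbelianGroupProperties +-abelianGroup using (⁻¹-∙-comm)
  open import Relation.Binary.Reasoning.Setoid setoid

  open MultiplesProperties semiring using (1+×; ×-homo-+; ×1-homo-*) renaming (_×_ to _×′_)

  -- With the optimised multiples ιℤ (+ 1) is 1# itself, so :1 below denotes 1# on the nose.
  ιℤ : ℤ → Carrier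
  ιℤ (+ m)    = m ×′ 1#
  ιℤ -[1+ m ] = - (suc m ×′ 1#)

  private
    1+a-[1+b]≈a-b : ∀ a b → (1# + a) - (1# + b) ≈ a - b
    1+a-[1+b]≈a-b a b = begin
      (1# + a) + - (1# + b)    ≈⟨ +-congˡ (⁻¹-∙-comm 1# b) ⟨
      (1# + a) + (- 1# + - b)  ≈⟨ +-congʳ (+-comm 1# a) ⟩
      (a + 1#) + (- 1# + - b)  ≈⟨ +-assoc a 1# _ ⟩
      a + (1# + (- 1# + - b))  ≈⟨ +-congˡ (+-assoc 1# (- 1#) (- b)) ⟨
      a + ((1# - 1#) + - b)    ≈⟨ +-congˡ (+-congʳ (-‿inverseʳ 1#)) ⟩
      a + (0# + - b)           ≈⟨ +-congˡ (+-identityˡ (- b)) ⟩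
      a - b                    ∎

    ιℤ-⊖ : ∀ m k → ιℤ (m ℤ.⊖ k) ≈ m ×′ 1# - k ×′ 1#
    ιℤ-⊖ zero    zero    = sym (-‿inverseʳ 0#)
    ιℤ-⊖ (suc m) zero    = trans (sym (+-identityʳ _)) (+-congˡ (sym -0#≈0#))
    ιℤ-⊖ zero    (suc k) = sym (+-identityˡ _)
    ιℤ-⊖ (suc m) (suc k) = begin
      ιℤ (suc m ℤ.⊖ suc k)               ≡⟨ ≡.cong ιℤ (ℤ.[1+m]⊖[1+n]≡m⊖n m k) ⟩
      ιℤ (m ℤ.⊖ k)                       ≈⟨ ιℤ-⊖ m k ⟩
      m ×′ 1# - k ×′ 1#                  ≈⟨ 1+a-[1+b]≈a-b _ _ ⟨
      (1# + m ×′ 1#) - (1# + k ×′ 1#)    ≈⟨ +-cong (1+× m 1#) (-‿cong (1+× k 1#)) ⟨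
      suc m ×′ 1# - suc k ×′ 1#          ∎

    ιℤ-‿homo : ∀ i → ιℤ (ℤ.- i) ≈ - ιℤ i
    ιℤ-‿homo (+ zero)  = sym -0#≈0#
    ιℤ-‿homo (+ suc m) = refl
    ιℤ-‿homo -[1+ m ]  = sym (-‿involutive _)

    ιℤ-+-homo : ∀ i j → ιℤ (i ℤ.+ j) ≈ ιℤ i + ιℤ j
    ιℤ-+-homo (+ m)    (+ k)    = ×-homo-+ 1# m k
    ιℤ-+-homo (+ m)    -[1+ k ] = ιℤ-⊖ m (suc k)
    ιℤ-+-homo -[1+ m ] (+ k)    = trans (ιℤ-⊖ k (suc m)) (+-comm _ _)
    ιℤ-+-homo -[1+ m ] -[1+ k ] = begin
      - (suc (suc m ℕ.+ k) ×′ 1#)        ≡⟨ ≡.cong (λ t → - (t ×′ 1#)) (ℕ.+-suc (suc m) k) ⟨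
      - ((suc m ℕ.+ suc k) ×′ 1#)        ≈⟨ -‿cong (×-homo-+ 1# (suc m) (suc k)) ⟩
      - (suc m ×′ 1# + suc k ×′ 1#)      ≈⟨ ⁻¹-∙-comm _ _ ⟨
      - (suc m ×′ 1#) + - (suc k ×′ 1#)  ∎

    ιℤ-+◃ : ∀ m → ιℤ (Sign.+ ℤ.◃ m) ≈ m ×′ 1#
    ιℤ-+◃ m = reflexive (≡.cong ιℤ (ℤ.+◃n≡+n m))

    ιℤ--◃ : ∀ m → ιℤ (Sign.- ℤ.◃ m) ≈ - (m ×′ 1#)
    ιℤ--◃ m = trans (reflexive (≡.cong ιℤ (ℤ.-◃n≡-n m))) (ιℤ-‿homo (+ m))

    ιℤ-*-homo : ∀ i j → ιℤ (i ℤ.* j) ≈ ιℤ i * ιℤ j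
    ιℤ-*-homo (+ m) (+ k) =
      trans (ιℤ-+◃ (m ℕ.* k)) (×1-homo-* m k)
    ιℤ-*-homo (+ m) -[1+ k ] =
      trans (ιℤ--◃ (m ℕ.* suc k)) (trans (-‿cong (×1-homo-* m (suc k))) (-‿distribʳ-* _ _))
    ιℤ-*-homo -[1+ m ] (+ k) =
      trans (ιℤ--◃ (suc m ℕ.* k)) (trans (-‿cong (×1-homo-* (suc m) k)) (-‿distribˡ-* _ _))
    ιℤ-*-homo -[1+ m ] -[1+ k ] = begin
      ιℤ (Sign.+ ℤ.◃ (suc m ℕ.* suc k))  ≈⟨ ιℤ-+◃ (suc m ℕ.* suc k) ⟩
      (suc m ℕ.* suc k) ×′ 1#            ≈⟨ ×1-homo-* (suc m) (suc k) ⟩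
      a * b                              ≈⟨ -‿involutive _ ⟨
      - - (a * b)                        ≈⟨ -‿cong (-‿distribˡ-* a b) ⟩
      - (- a * b)                        ≈⟨ -‿distribʳ-* _ _ ⟩
      - a * - b                          ∎
      where a = suc m ×′ 1#
            b = suc k ×′ 1#

    ring′ : AlmostCommutativeRing c ℓ
    ring′ = fromCommutativeRing R

    ιℤ-homomorphism : ℤ.+-*-rawRing -Raw-AlmostCommutative⟶ ring′
    ιℤ-homomorphism = record
      { ⟦_⟧    = ιℤ
      ; +-homo = ιℤ-+-homo
      ; *-homo = ιℤ-*-homo
      ; -‿homo = ιℤ-‿homo
      ; 0-homo = refl
      ; 1-homo = refl
      }

    ιℤ-≟ : ∀ i j → Maybe (ιℤ i ≈ ιℤ j)
    ιℤ-≟ i j with i ℤ.≟ j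
    ... | yes ≡.refl = just refl
    ... | no _       = nothing

  open Algebra.Solver.Ring ℤ.+-*-rawRing ring′ ιℤ-homomorphism ιℤ-≟ public

  :0 :1 : ∀ {k} → Polynomial k
  :0 = con (+ 0)
  :1 = con (+ 1)

module NaturalEmbedding {c ℓ : Level} (R : CommutativeRing c ℓ) where
  open CommutativeRing R hiding (zero)
  open Over R using (ι)
  open IntegerCoefficientSolver R
  open import Relation.Binary.Reasoning.Setoid setoid

  ι-+ : ∀ m k → ι (m ℕ.+ k) ≈ ι m + ι k
  ι-+ zero k = sym (+-identityˡ _)
  ι-+ (suc m) k = trans (+-congˡ (ι-+ m k)) (sym (+-assoc _ _ _))

  ι-∸ : ∀ {m i} → i ≤ m → ι (m ∸ i) ≈ ι m - ι i
  ι-∸ {m} {i} i≤m = begin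
    ι (m ∸ i)                ≈⟨ solve 2 (λ a b → a := (a :+ b) :- b) refl (ι (m ∸ i)) (ι i) ⟩
    (ι (m ∸ i) + ι i) - ι i  ≈⟨ +-congʳ (ι-+ (m ∸ i) i) ⟨
    ι (m ∸ i ℕ.+ i) - ι i    ≡⟨ ≡.cong (λ t → ι t - ι i) (ℕ.m∸n+n≡m i≤m) ⟩
    ι m - ι i                ∎

  ι-double : ∀ i → ι (2 ℕ.* i) ≈ ι i + ι i
  ι-double i = trans (ι-+ i (i ℕ.+ 0)) (+-congˡ (reflexive (≡.cong ι (ℕ.+-identityʳ i))))

-- A form f of degree m is given by its coefficients: it stands for
-- Σ_{i ≤ m} f i · x^(m ∸ i) · y^i, and the coefficients beyond m are meant to vanish.
module Forms {c ℓ : Level} (R : CommutativeRing c ℓ) where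
  open CommutativeRing R hiding (zero)
  open Over R using (ι)
  open IntegerCoefficientSolver R
  open import Relation.Binary.Reasoning.Setoid setoid

  Form : Set c
  Form = ℕ → Carrier

  infix 4 _≈ᶠ_
  _≈ᶠ_ : Form → Form → Set ℓ
  f ≈ᶠ g = ∀ i → f i ≈ g i

  ≈ᶠ-sym : ∀ {f g} → f ≈ᶠ g → g ≈ᶠ f
  ≈ᶠ-sym f≈g i = sym (f≈g i)

  ≈ᶠ-trans : ∀ {f g h} → f ≈ᶠ g → g ≈ᶠ h → f ≈ᶠ h
  ≈ᶠ-trans f≈g g≈h i = trans (f≈g i) (g≈h i)

  VanishesAbove : ℕ → Form → Set ℓ
  VanishesAbove m f = ∀ i → m < i → f i ≈ 0#

  xPower : Form
  xPower zero    = 1#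
  xPower (suc _) = 0#

  yMul : Form → Form
  yMul f zero    = 0#
  yMul f (suc i) = f i

  tail : Form → Form
  tail f i = f (suc i)

  linearMul : Carrier → Carrier → Form → Form
  linearMul p q f i = p * f i + q * yMul f i

  x*0+y*0≈0 : ∀ x y → x * 0# + y * 0# ≈ 0#
  x*0+y*0≈0 = solve 2 (λ x y → x :* :0 :+ y :* :0 := :0) refl

  xPower-vanishesAbove : ∀ m → VanishesAbove m xPower
  xPower-vanishesAbove m (suc i) _ = refl

  yMul-vanishesAbove : ∀ {m f} → VanishesAbove m f → VanishesAbove (suc m) (yMul f)
  yMul-vanishesAbove f↓ (suc i) (s≤s m<i) = f↓ i m<i

  tail-vanishesAbove : ∀ {m f} → VanishesAbove (suc m) f → VanishesAbove m (tail f)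
  tail-vanishesAbove f↓ i m<i = f↓ (suc i) (s≤s m<i)

  linearMul-vanishesAbove : ∀ {m f} p q → VanishesAbove m f → VanishesAbove (suc m) (linearMul p q f)
  linearMul-vanishesAbove {m} {f} p q f↓ i m<i = begin
    p * f i + q * yMul f i
      ≈⟨ +-cong (*-congˡ (f↓ i (ℕ.<-trans (ℕ.n<1+n m) m<i))) (*-congˡ (yMul-vanishesAbove f↓ i m<i)) ⟩
    p * 0# + q * 0#         ≈⟨ x*0+y*0≈0 p q ⟩
    0#                      ∎

  vanishesAbove-0 : ∀ {f} → VanishesAbove 0 f → f ≈ᶠ λ i → f 0 * xPower i
  vanishesAbove-0 {f} f↓ zero    = sym (*-identityʳ (f 0))
  vanishesAbove-0 {f} f↓ (suc i) = trans (f↓ (suc i) (s≤s z≤n)) (sym (zeroʳ (f 0)))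

  split : ∀ f → f ≈ᶠ λ i → f 0 * xPower i + 1# * yMul (tail f) i
  split f zero    = solve 1 (λ x → x := x :* :1 :+ :1 :* :0) refl (f 0)
  split f (suc i) = solve 2 (λ x y → y := x :* :0 :+ :1 :* y) refl (f 0) (f (suc i))

  yMul-cong : ∀ {f g} → f ≈ᶠ g → yMul f ≈ᶠ yMul g
  yMul-cong f≈g zero    = refl
  yMul-cong f≈g (suc i) = f≈g i

  linearMul-cong : ∀ p q {f g} → f ≈ᶠ g → linearMul p q f ≈ᶠ linearMul p q g
  linearMul-cong p q f≈g i = +-cong (*-congˡ (f≈g i)) (*-congˡ (yMul-cong f≈g i))

  linearMul-congᶜ : ∀ {p q p′ q′} f → p ≈ p′ → q ≈ q′ → linearMul p q f ≈ᶠ linearMul p′ q′ f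
  linearMul-congᶜ f p≈p′ q≈q′ i = +-cong (*-congʳ p≈p′) (*-congʳ q≈q′)

  linearMul-linear : ∀ p q k₁ k₂ f g →
    linearMul p q (λ i → k₁ * f i + k₂ * g i) ≈ᶠ λ i → k₁ * linearMul p q f i + k₂ * linearMul p q g i
  linearMul-linear p q k₁ k₂ f g zero = solve 6 (λ p q k₁ k₂ f₀ g₀ →
      p :* (k₁ :* f₀ :+ k₂ :* g₀) :+ q :* :0 := k₁ :* (p :* f₀ :+ q :* :0) :+ k₂ :* (p :* g₀ :+ q :* :0)) refl
      p q k₁ k₂ (f 0) (g 0)
  linearMul-linear p q k₁ k₂ f g (suc i) = solve 8 (λ p q k₁ k₂ f₀ g₀ f₁ g₁ →
      p :* (k₁ :* f₁ :+ k₂ :* g₁) :+ q :* (k₁ :* f₀ :+ k₂ :* g₀)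
        := k₁ :* (p :* f₁ :+ q :* f₀) :+ k₂ :* (p :* g₁ :+ q :* g₀)) refl
      p q k₁ k₂ (f i) (g i) (f (suc i)) (g (suc i))

  linearMul-zero : ∀ p q {f} → f ≈ᶠ (λ _ → 0#) → linearMul p q f ≈ᶠ λ _ → 0#
  linearMul-zero p q f≈0 zero    = trans (linearMul-cong p q f≈0 0) (x*0+y*0≈0 p q)
  linearMul-zero p q f≈0 (suc i) = trans (linearMul-cong p q f≈0 (suc i)) (x*0+y*0≈0 p q)

  linearMul-+ : ∀ p q f g → linearMul p q (λ i → f i + g i) ≈ᶠ λ i → linearMul p q f i + linearMul p q g i
  linearMul-+ p q f g zero = solve 4 (λ p q f₀ g₀ →
      p :* (f₀ :+ g₀) :+ q :* :0 := (p :* f₀ :+ q :* :0) :+ (p :* g₀ :+ q :* :0)) refl p q (f 0) (g 0)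
  linearMul-+ p q f g (suc i) = solve 6 (λ p q f₀ g₀ f₁ g₁ →
      p :* (f₁ :+ g₁) :+ q :* (f₀ :+ g₀) := (p :* f₁ :+ q :* f₀) :+ (p :* g₁ :+ q :* g₀)) refl
      p q (f i) (g i) (f (suc i)) (g (suc i))

  linearMul-* : ∀ p q k f → linearMul p q (λ i → k * f i) ≈ᶠ λ i → k * linearMul p q f i
  linearMul-* p q k f zero = solve 4 (λ p q k f₀ →
      p :* (k :* f₀) :+ q :* :0 := k :* (p :* f₀ :+ q :* :0)) refl p q k (f 0)
  linearMul-* p q k f (suc i) = solve 5 (λ p q k f₀ f₁ →
      p :* (k :* f₁) :+ q :* (k :* f₀) := k :* (p :* f₁ :+ q :* f₀)) refl p q k (f i) (f (suc i))

  linearMul-combine : ∀ u v p q p′ q′ f →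
    (λ i → u * linearMul p q f i + v * linearMul p′ q′ f i) ≈ᶠ linearMul (u * p + v * p′) (u * q + v * q′) f
  linearMul-combine u v p q p′ q′ f i = solve 8 (λ u v p q p′ q′ x y →
      u :* (p :* x :+ q :* y) :+ v :* (p′ :* x :+ q′ :* y) := (u :* p :+ v :* p′) :* x :+ (u :* q :+ v :* q′) :* y) refl
      u v p q p′ q′ (f i) (yMul f i)

  linearMul-comm : ∀ p q p′ q′ f → linearMul p′ q′ (linearMul p q f) ≈ᶠ linearMul p q (linearMul p′ q′ f)
  linearMul-comm p q p′ q′ f zero = solve 5 (λ p q p′ q′ f₀ →
      p′ :* (p :* f₀ :+ q :* :0) :+ q′ :* :0 := p :* (p′ :* f₀ :+ q′ :* :0) :+ q :* :0) refl p q p′ q′ (f 0)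
  linearMul-comm p q p′ q′ f (suc zero) = solve 6 (λ p q p′ q′ f₀ f₁ →
      p′ :* (p :* f₁ :+ q :* f₀) :+ q′ :* (p :* f₀ :+ q :* :0)
        := p :* (p′ :* f₁ :+ q′ :* f₀) :+ q :* (p′ :* f₀ :+ q′ :* :0)) refl
      p q p′ q′ (f 0) (f 1)
  linearMul-comm p q p′ q′ f (suc (suc i)) = solve 7 (λ p q p′ q′ f₀ f₁ f₂ →
      p′ :* (p :* f₂ :+ q :* f₁) :+ q′ :* (p :* f₁ :+ q :* f₀)
        := p :* (p′ :* f₂ :+ q′ :* f₁) :+ q :* (p′ :* f₁ :+ q′ :* f₀)) refl
      p q p′ q′ (f i) (f (suc i)) (f (suc (suc i)))

  linearMul-x : ∀ f → linearMul 1# 0# f ≈ᶠ f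
  linearMul-x f i = solve 2 (λ x y → :1 :* x :+ :0 :* y := x) refl (f i) (yMul f i)

  linearMul-y : ∀ f → linearMul 0# 1# f ≈ᶠ yMul f
  linearMul-y f i = solve 2 (λ x y → :0 :* x :+ :1 :* y := y) refl (f i) (yMul f i)

  -- ∂ m acts on forms of degree m as the derivation a x∂ₓ + b y∂ₓ + g x∂ᵧ + d y∂ᵧ.
  module Derivation (a b g d : Carrier) where
    weight : ℕ → ℕ → Carrier
    weight m i = (ι m - ι i) * a + ι i * d

    ∂ : ℕ → Form → Form
    ∂ m f zero    = weight m zero * f zero + ι 1 * g * f 1
    ∂ m f (suc i) = weight m (suc i) * f (suc i) + (ι m - ι i) * b * f i + ι (suc (suc i)) * g * f (suc (suc i))

    ∂-cong : ∀ m {f h} → f ≈ᶠ h → ∂ m f ≈ᶠ ∂ m h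
    ∂-cong m f≈h zero    = +-cong (*-congˡ (f≈h 0)) (*-congˡ (f≈h 1))
    ∂-cong m f≈h (suc i) = +-cong (+-cong (*-congˡ (f≈h (suc i))) (*-congˡ (f≈h i))) (*-congˡ (f≈h (suc (suc i))))

    ∂-linear : ∀ m k₁ k₂ f h → ∂ m (λ i → k₁ * f i + k₂ * h i) ≈ᶠ λ i → k₁ * ∂ m f i + k₂ * ∂ m h i
    ∂-linear m k₁ k₂ f h zero = solve 8 (λ k₁ k₂ X W f₀ f₁ h₀ h₁ →
        X :* (k₁ :* f₀ :+ k₂ :* h₀) :+ W :* (k₁ :* f₁ :+ k₂ :* h₁)
      := k₁ :* (X :* f₀ :+ W :* f₁) :+ k₂ :* (X :* h₀ :+ W :* h₁)) refl
      k₁ k₂ (weight m zero) (ι 1 * g) (f 0) (f 1) (h 0) (h 1)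
    ∂-linear m k₁ k₂ f h (suc i) = solve 11 (λ k₁ k₂ X Z W f₀ f₁ f₂ h₀ h₁ h₂ →
        X :* (k₁ :* f₁ :+ k₂ :* h₁) :+ Z :* (k₁ :* f₀ :+ k₂ :* h₀) :+ W :* (k₁ :* f₂ :+ k₂ :* h₂)
      := k₁ :* (X :* f₁ :+ Z :* f₀ :+ W :* f₂) :+ k₂ :* (X :* h₁ :+ Z :* h₀ :+ W :* h₂)) refl
      k₁ k₂ (weight m (suc i)) ((ι m - ι i) * b) (ι (suc (suc i)) * g)
      (f i) (f (suc i)) (f (suc (suc i))) (h i) (h (suc i)) (h (suc (suc i)))

    ∂-* : ∀ m k f → ∂ m (λ i → k * f i) ≈ᶠ λ i → k * ∂ m f i
    ∂-* m k f zero = solve 5 (λ k X W f₀ f₁ → X :* (k :* f₀) :+ W :* (k :* f₁) := k :* (X :* f₀ :+ W :* f₁)) refl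
      k (weight m zero) (ι 1 * g) (f 0) (f 1)
    ∂-* m k f (suc i) = solve 7 (λ k X Z W f₀ f₁ f₂ →
        X :* (k :* f₁) :+ Z :* (k :* f₀) :+ W :* (k :* f₂) := k :* (X :* f₁ :+ Z :* f₀ :+ W :* f₂)) refl
      k (weight m (suc i)) ((ι m - ι i) * b) (ι (suc (suc i)) * g) (f i) (f (suc i)) (f (suc (suc i)))

    ∂-leibniz : ∀ m p q f →
      ∂ (suc m) (linearMul p q f) ≈ᶠ λ i → linearMul (p * a + q * g) (p * b + q * d) f i + linearMul p q (∂ m f) i
    ∂-leibniz m p q f zero = solve 9 (λ a b g d p q M f₀ f₁ →
        (((:1 :+ M) :- :0) :* a :+ :0 :* d) :* (p :* f₀ :+ q :* :0) :+ (:1 :+ :0) :* g :* (p :* f₁ :+ q :* f₀)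
      := ((p :* a :+ q :* g) :* f₀ :+ (p :* b :+ q :* d) :* :0)
         :+ (p :* (((M :- :0) :* a :+ :0 :* d) :* f₀ :+ (:1 :+ :0) :* g :* f₁) :+ q :* :0)) refl
      a b g d p q (ι m) (f 0) (f 1)
    ∂-leibniz m p q f (suc zero) = solve 10 (λ a b g d p q M f₀ f₁ f₂ →
        (((:1 :+ M) :- (:1 :+ :0)) :* a :+ (:1 :+ :0) :* d) :* (p :* f₁ :+ q :* f₀)
          :+ ((:1 :+ M) :- :0) :* b :* (p :* f₀ :+ q :* :0)
          :+ (:1 :+ (:1 :+ :0)) :* g :* (p :* f₂ :+ q :* f₁)
      := ((p :* a :+ q :* g) :* f₁ :+ (p :* b :+ q :* d) :* f₀)
         :+ (p :* (((M :- (:1 :+ :0)) :* a :+ (:1 :+ :0) :* d) :* f₁ :+ (M :- :0) :* b :* f₀ :+ (:1 :+ (:1 :+ :0)) :* g :* f₂)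
             :+ q :* (((M :- :0) :* a :+ :0 :* d) :* f₀ :+ (:1 :+ :0) :* g :* f₁))) refl
      a b g d p q (ι m) (f 0) (f 1) (f 2)
    ∂-leibniz m p q f (suc (suc i)) = solve 12 (λ a b g d p q M N f₀ f₁ f₂ f₃ →
        (((:1 :+ M) :- (:1 :+ (:1 :+ N))) :* a :+ (:1 :+ (:1 :+ N)) :* d) :* (p :* f₂ :+ q :* f₁)
          :+ ((:1 :+ M) :- (:1 :+ N)) :* b :* (p :* f₁ :+ q :* f₀)
          :+ (:1 :+ (:1 :+ (:1 :+ N))) :* g :* (p :* f₃ :+ q :* f₂)
      := ((p :* a :+ q :* g) :* f₂ :+ (p :* b :+ q :* d) :* f₁)
         :+ (p :* (((M :- (:1 :+ (:1 :+ N))) :* a :+ (:1 :+ (:1 :+ N)) :* d) :* f₂ :+ (M :- (:1 :+ N)) :* b :* f₁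
                   :+ (:1 :+ (:1 :+ (:1 :+ N))) :* g :* f₃)
             :+ q :* (((M :- (:1 :+ N)) :* a :+ (:1 :+ N) :* d) :* f₁ :+ (M :- N) :* b :* f₀ :+ (:1 :+ (:1 :+ N)) :* g :* f₂))) refl
      a b g d p q (ι m) (ι i) (f i) (f (suc i)) (f (suc (suc i))) (f (suc (suc (suc i))))

    ∂-xPower : ∀ m → ∂ m xPower ≈ᶠ λ i → ι m * linearMul a b xPower i
    ∂-xPower m zero = solve 5 (λ a b d g M →
        ((M :- :0) :* a :+ :0 :* d) :* :1 :+ (:1 :+ :0) :* g :* :0 := M :* (a :* :1 :+ b :* :0)) refl a b d g (ι m)
    ∂-xPower m (suc zero) = solve 5 (λ a b X W M →
        X :* :0 :+ (M :- :0) :* b :* :1 :+ W :* :0 := M :* (a :* :0 :+ b :* :1)) refl a b (weight m 1) (ι 2 * g) (ι m)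
    ∂-xPower m (suc (suc i)) = solve 6 (λ a b X Z W M →
        X :* :0 :+ Z :* :0 :+ W :* :0 := M :* (a :* :0 :+ b :* :0)) refl
      a b (weight m (suc (suc i))) ((ι m - ι (suc i)) * b) (ι (suc (suc (suc i))) * g) (ι m)

    ∂-split : ∀ m f → ∂ (suc m) f ≈ᶠ λ j →
      (f 0 * ι (suc m)) * linearMul a b xPower j + 1# * (1# * linearMul g d (tail f) j + 1# * yMul (∂ m (tail f)) j)
    ∂-split m f j = begin
      ∂ (suc m) f j
        ≈⟨ ∂-cong (suc m) (split f) j ⟩
      ∂ (suc m) (λ k → f 0 * xPower k + 1# * yMul t k) j
        ≈⟨ ∂-linear (suc m) (f 0) 1# xPower (yMul t) j ⟩
      f 0 * ∂ (suc m) xPower j + 1# * ∂ (suc m) (yMul t) j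
        ≈⟨ +-cong (*-congˡ (∂-xPower (suc m) j)) (*-congˡ (∂-cong (suc m) (≈ᶠ-sym (linearMul-y t)) j)) ⟩
      f 0 * (M * linearMul a b xPower j) + 1# * ∂ (suc m) (linearMul 0# 1# t) j
        ≈⟨ +-congˡ (*-congˡ (∂-leibniz m 0# 1# t j)) ⟩
      f 0 * (M * linearMul a b xPower j) + 1# * (linearMul (0# * a + 1# * g) (0# * b + 1# * d) t j + linearMul 0# 1# (∂ m t) j)
        ≈⟨ +-congˡ (*-congˡ (+-cong (linearMul-congᶜ t (0*x+1*y≈y a g) (0*x+1*y≈y b d) j)
                                    (linearMul-y (∂ m t) j))) ⟩
      f 0 * (M * linearMul a b xPower j) + 1# * (linearMul g d t j + yMul (∂ m t) j)
        ≈⟨ solve 5 (λ x M E G H → x :* (M :* E) :+ :1 :* (G :+ H) := (x :* M) :* E :+ :1 :* (:1 :* G :+ :1 :* H)) refl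
             (f 0) M (linearMul a b xPower j) (linearMul g d t j) (yMul (∂ m t) j) ⟩
      (f 0 * M) * linearMul a b xPower j + 1# * (1# * linearMul g d t j + 1# * yMul (∂ m t) j) ∎
      where t = tail f
            M = ι (suc m)
            0*x+1*y≈y : ∀ x y → 0# * x + 1# * y ≈ y
            0*x+1*y≈y = solve 2 (λ x y → :0 :* x :+ :1 :* y := y) refl

    ∂-vanishesAbove : ∀ m {f} → VanishesAbove m f → VanishesAbove m (∂ m f)
    ∂-vanishesAbove m {f} f↓ (suc i) m<1+i with ℕ.m≤n⇒m<n∨m≡n (ℕ.≤-pred m<1+i)
    ... | inj₁ m<i = begin
      weight m (suc i) * f (suc i) + (ι m - ι i) * b * f i + ι (suc (suc i)) * g * f (suc (suc i))
        ≈⟨ +-cong (+-cong (*-congˡ (f↓ (suc i) m<1+i)) (*-congˡ (f↓ i m<i)))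
                  (*-congˡ (f↓ (suc (suc i)) (ℕ.<-trans m<1+i (ℕ.n<1+n _)))) ⟩
      weight m (suc i) * 0# + (ι m - ι i) * b * 0# + ι (suc (suc i)) * g * 0#
        ≈⟨ solve 3 (λ x y z → x :* :0 :+ y :* :0 :+ z :* :0 := :0) refl _ _ _ ⟩
      0# ∎
    ... | inj₂ ≡.refl = begin
      weight m (suc m) * f (suc m) + (ι m - ι m) * b * f m + ι (suc (suc m)) * g * f (suc (suc m))
        ≈⟨ +-cong (+-cong (*-congˡ (f↓ (suc m) m<1+i)) refl)
                  (*-congˡ (f↓ (suc (suc m)) (ℕ.<-trans m<1+i (ℕ.n<1+n _)))) ⟩
      weight m (suc m) * 0# + (ι m - ι m) * b * f m + ι (suc (suc m)) * g * 0#
        ≈⟨ solve 5 (λ x M b fₘ z → x :* :0 :+ (M :- M) :* b :* fₘ :+ z :* :0 := :0) refl _ (ι m) b (f m) _ ⟩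
      0# ∎

  -- subst m f is the form f(p x + q y, r x + s y) of degree m, computed from f = f 0 · xᵐ + y · tail f.
  module Substitution (p q r s : Carrier) where
    linearPower : ℕ → Form
    linearPower zero    = xPower
    linearPower (suc m) = linearMul p q (linearPower m)

    subst : ℕ → Form → Form
    subst zero    f i = f 0 * xPower i
    subst (suc m) f i = f 0 * linearPower (suc m) i + linearMul r s (subst m (tail f)) i

    subst-cong : ∀ m {f h} → f ≈ᶠ h → subst m f ≈ᶠ subst m h
    subst-cong zero    f≈h i = *-congʳ (f≈h 0)
    subst-cong (suc m) f≈h i = +-cong (*-congʳ (f≈h 0)) (linearMul-cong r s (subst-cong m (λ j → f≈h (suc j))) i)

    subst-linear : ∀ m k₁ k₂ f h → subst m (λ i → k₁ * f i + k₂ * h i) ≈ᶠ λ i → k₁ * subst m f i + k₂ * subst m h i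
    subst-linear zero k₁ k₂ f h i = solve 5 (λ k₁ k₂ f₀ h₀ e →
      (k₁ :* f₀ :+ k₂ :* h₀) :* e := k₁ :* (f₀ :* e) :+ k₂ :* (h₀ :* e)) refl k₁ k₂ (f 0) (h 0) (xPower i)
    subst-linear (suc m) k₁ k₂ f h i = begin
      (k₁ * f 0 + k₂ * h 0) * P + linearMul r s (subst m (λ j → k₁ * f (suc j) + k₂ * h (suc j))) i
        ≈⟨ +-congˡ (linearMul-cong r s (subst-linear m k₁ k₂ (tail f) (tail h)) i) ⟩
      (k₁ * f 0 + k₂ * h 0) * P + linearMul r s (λ j → k₁ * subst m (tail f) j + k₂ * subst m (tail h) j) i
        ≈⟨ +-congˡ (linearMul-linear r s k₁ k₂ _ _ i) ⟩
      (k₁ * f 0 + k₂ * h 0) * P + (k₁ * linearMul r s (subst m (tail f)) i + k₂ * linearMul r s (subst m (tail h)) i)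
        ≈⟨ solve 7 (λ k₁ k₂ f₀ h₀ P F H →
             (k₁ :* f₀ :+ k₂ :* h₀) :* P :+ (k₁ :* F :+ k₂ :* H) := k₁ :* (f₀ :* P :+ F) :+ k₂ :* (h₀ :* P :+ H)) refl
             k₁ k₂ (f 0) (h 0) P _ _ ⟩
      k₁ * subst (suc m) f i + k₂ * subst (suc m) h i ∎
      where P = linearPower (suc m) i

    subst-yMul : ∀ m f → subst (suc m) (yMul f) ≈ᶠ linearMul r s (subst m f)
    subst-yMul m f i = solve 2 (λ P F → :0 :* P :+ F := F) refl (linearPower (suc m) i) (linearMul r s (subst m f) i)

    subst-zero : ∀ m → subst m (λ _ → 0#) ≈ᶠ λ _ → 0#
    subst-zero zero    i = zeroˡ _
    subst-zero (suc m) i = trans (+-cong (zeroˡ _) (linearMul-zero r s (subst-zero m) i)) (+-identityʳ _)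

    linearPower-vanishesAbove : ∀ m → VanishesAbove m (linearPower m)
    linearPower-vanishesAbove zero    = xPower-vanishesAbove 0
    linearPower-vanishesAbove (suc m) = linearMul-vanishesAbove p q (linearPower-vanishesAbove m)

    subst-vanishesAbove : ∀ m f → VanishesAbove m (subst m f)
    subst-vanishesAbove zero    f (suc i) _   = zeroʳ _
    subst-vanishesAbove (suc m) f i       m<i = begin
      f 0 * linearPower (suc m) i + linearMul r s (subst m (tail f)) i
        ≈⟨ +-cong (*-congˡ (linearPower-vanishesAbove (suc m) i m<i))
                  (linearMul-vanishesAbove r s (subst-vanishesAbove m (tail f)) i m<i) ⟩
      f 0 * 0# + 0#  ≈⟨ solve 1 (λ x → x :* :0 :+ :0 := :0) refl (f 0) ⟩
      0#             ∎

    subst-xPower : ∀ m → subst m xPower ≈ᶠ linearPower m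
    subst-xPower zero    i = *-identityˡ _
    subst-xPower (suc m) i = trans (+-cong (*-identityˡ _) (linearMul-zero r s (subst-zero m) i)) (+-identityʳ _)

    -- Read in degree m + 1, the coefficients of a form f of degree m describe x · f.
    subst-xMul : ∀ m {f} → VanishesAbove m f → subst (suc m) f ≈ᶠ linearMul p q (subst m f)
    subst-xMul zero {f} f↓ i = begin
      f 0 * linearMul p q xPower i + linearMul r s (subst zero (tail f)) i
        ≈⟨ +-congˡ (linearMul-zero r s (λ j → trans (*-congʳ (f↓ 1 (s≤s z≤n))) (zeroˡ _)) i) ⟩
      f 0 * linearMul p q xPower i + 0#  ≈⟨ +-identityʳ _ ⟩
      f 0 * linearMul p q xPower i       ≈⟨ linearMul-* p q (f 0) xPower i ⟨
      linearMul p q (subst zero f) i     ∎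
    subst-xMul (suc m) {f} f↓ i = begin
      f 0 * linearMul p q (linearPower (suc m)) i + linearMul r s (subst (suc m) (tail f)) i
        ≈⟨ +-congˡ (linearMul-cong r s (subst-xMul m (tail-vanishesAbove f↓)) i) ⟩
      f 0 * linearMul p q (linearPower (suc m)) i + linearMul r s (linearMul p q (subst m (tail f))) i
        ≈⟨ +-congˡ (linearMul-comm p q r s _ i) ⟩
      f 0 * linearMul p q (linearPower (suc m)) i + linearMul p q (linearMul r s (subst m (tail f))) i
        ≈⟨ +-congʳ (linearMul-* p q (f 0) _ i) ⟨
      linearMul p q (λ j → f 0 * linearPower (suc m) j) i + linearMul p q (linearMul r s (subst m (tail f))) i
        ≈⟨ linearMul-+ p q _ _ i ⟨
      linearMul p q (subst (suc m) f) i ∎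

    subst-linearMul : ∀ m u v {f} → VanishesAbove m f →
      subst (suc m) (linearMul u v f) ≈ᶠ linearMul (u * p + v * r) (u * q + v * s) (subst m f)
    subst-linearMul m u v {f} f↓ i = begin
      subst (suc m) (linearMul u v f) i                         ≈⟨ subst-linear (suc m) u v f (yMul f) i ⟩
      u * subst (suc m) f i + v * subst (suc m) (yMul f) i
        ≈⟨ +-cong (*-congˡ (subst-xMul m f↓ i)) (*-congˡ (subst-yMul m f i)) ⟩
      u * linearMul p q (subst m f) i + v * linearMul r s (subst m f) i
        ≈⟨ linearMul-combine u v p q r s _ i ⟩
      linearMul (u * p + v * r) (u * q + v * s) (subst m f) i   ∎

  -- The hypotheses say S M′ = M S for S = (p q; r s), M = (a b; g d) and M′ = (a′ b′; g′ d′).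
  module Intertwining (a b g d a′ b′ g′ d′ p q r s : Carrier)
    (SM′≈MS₁₁ : p * a′ + q * g′ ≈ a * p + b * r) (SM′≈MS₁₂ : p * b′ + q * d′ ≈ a * q + b * s)
    (SM′≈MS₂₁ : r * a′ + s * g′ ≈ g * p + d * r) (SM′≈MS₂₂ : r * b′ + s * d′ ≈ g * q + d * s) where
    module D = Derivation a b g d
    module D′ = Derivation a′ b′ g′ d′
    open Substitution p q r s

    ∂′-linearPower : ∀ m → D′.∂ (suc m) (linearPower (suc m)) ≈ᶠ
      λ i → ι (suc m) * linearMul (p * a′ + q * g′) (p * b′ + q * d′) (linearPower m) i
    ∂′-linearPower zero i = begin
      D′.∂ 1 (linearMul p q xPower) i                         ≈⟨ D′.∂-leibniz 0 p q xPower i ⟩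
      linearMul k₁ k₂ xPower i + linearMul p q (D′.∂ 0 xPower) i
        ≈⟨ +-congˡ (linearMul-zero p q (λ j → trans (D′.∂-xPower 0 j) (zeroˡ _)) i) ⟩
      linearMul k₁ k₂ xPower i + 0#                           ≈⟨ solve 1 (λ x → x :+ :0 := (:1 :+ :0) :* x) refl _ ⟩
      ι 1 * linearMul k₁ k₂ xPower i                          ∎
      where k₁ = p * a′ + q * g′
            k₂ = p * b′ + q * d′
    ∂′-linearPower (suc m) i = begin
      D′.∂ (suc (suc m)) (linearMul p q (linearPower (suc m))) i
        ≈⟨ D′.∂-leibniz (suc m) p q (linearPower (suc m)) i ⟩
      linearMul k₁ k₂ (linearPower (suc m)) i + linearMul p q (D′.∂ (suc m) (linearPower (suc m))) i
        ≈⟨ +-congˡ (linearMul-cong p q (∂′-linearPower m) i) ⟩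
      linearMul k₁ k₂ (linearPower (suc m)) i + linearMul p q (λ j → ι (suc m) * linearMul k₁ k₂ (linearPower m) j) i
        ≈⟨ +-congˡ (linearMul-* p q (ι (suc m)) _ i) ⟩
      linearMul k₁ k₂ (linearPower (suc m)) i + ι (suc m) * linearMul p q (linearMul k₁ k₂ (linearPower m)) i
        ≈⟨ +-congˡ (*-congˡ (linearMul-comm k₁ k₂ p q (linearPower m) i)) ⟩
      linearMul k₁ k₂ (linearPower (suc m)) i + ι (suc m) * linearMul k₁ k₂ (linearPower (suc m)) i
        ≈⟨ solve 2 (λ x M → x :+ M :* x := (:1 :+ M) :* x) refl _ (ι (suc m)) ⟩
      ι (suc (suc m)) * linearMul k₁ k₂ (linearPower (suc m)) i ∎
      where k₁ = p * a′ + q * g′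
            k₂ = p * b′ + q * d′

    ∂′-subst : ∀ m f → VanishesAbove m f → D′.∂ m (subst m f) ≈ᶠ subst m (D.∂ m f)
    ∂′-subst zero f f↓ i = begin
      D′.∂ 0 (λ j → f 0 * xPower j) i  ≈⟨ D′.∂-* 0 (f 0) xPower i ⟩
      f 0 * D′.∂ 0 xPower i            ≈⟨ *-congˡ (D′.∂-xPower 0 i) ⟩
      f 0 * (0# * linearMul a′ b′ xPower i)
        ≈⟨ solve 6 (λ x y a d g e → x :* (:0 :* y) := (((:0 :- :0) :* a :+ :0 :* d) :* x :+ (:1 :+ :0) :* g :* :0) :* e) refl
             (f 0) (linearMul a′ b′ xPower i) a d g (xPower i) ⟩
      (D.weight 0 0 * f 0 + ι 1 * g * 0#) * xPower i ≈⟨ *-congʳ (+-congˡ (*-congˡ (sym (f↓ 1 (s≤s z≤n))))) ⟩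
      subst 0 (D.∂ 0 f) i ∎
    ∂′-subst (suc m) f f↓ i = trans ∂′-subst-lhs (sym ∂′-subst-rhs)
      where
      t = tail f
      M = ι (suc m)
      U = linearMul (a * p + b * r) (a * q + b * s) (linearPower m) i
      V = linearMul (g * p + d * r) (g * q + d * s) (subst m t) i
      W = linearMul r s (subst m (D.∂ m t)) i

      ∂′-subst-lhs : D′.∂ (suc m) (subst (suc m) f) i ≈ f 0 * (M * U) + 1# * (V + W)
      ∂′-subst-lhs = begin
        D′.∂ (suc m) (subst (suc m) f) i
          ≈⟨ D′.∂-cong (suc m) (λ j → +-congˡ (sym (*-identityˡ _))) i ⟩
        D′.∂ (suc m) (λ j → f 0 * linearPower (suc m) j + 1# * linearMul r s (subst m t) j) i
          ≈⟨ D′.∂-linear (suc m) (f 0) 1# (linearPower (suc m)) (linearMul r s (subst m t)) i ⟩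
        f 0 * D′.∂ (suc m) (linearPower (suc m)) i + 1# * D′.∂ (suc m) (linearMul r s (subst m t)) i
          ≈⟨ +-cong (*-congˡ (∂′-linearPower m i)) (*-congˡ (D′.∂-leibniz m r s (subst m t) i)) ⟩
        f 0 * (M * linearMul (p * a′ + q * g′) (p * b′ + q * d′) (linearPower m) i)
          + 1# * (linearMul (r * a′ + s * g′) (r * b′ + s * d′) (subst m t) i + linearMul r s (D′.∂ m (subst m t)) i)
          ≈⟨ +-cong (*-congˡ (*-congˡ (linearMul-congᶜ (linearPower m) SM′≈MS₁₁ SM′≈MS₁₂ i)))
                    (*-congˡ (+-cong (linearMul-congᶜ (subst m t) SM′≈MS₂₁ SM′≈MS₂₂ i)
                                     (linearMul-cong r s (∂′-subst m t (tail-vanishesAbove f↓)) i))) ⟩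
        f 0 * (M * U) + 1# * (V + W) ∎

      ∂′-subst-rhs : subst (suc m) (D.∂ (suc m) f) i ≈ f 0 * (M * U) + 1# * (V + W)
      ∂′-subst-rhs = begin
        subst (suc m) (D.∂ (suc m) f) i
          ≈⟨ subst-cong (suc m) (D.∂-split m f) i ⟩
        subst (suc m) (λ j → (f 0 * M) * linearMul a b xPower j + 1# * (1# * linearMul g d t j + 1# * yMul (D.∂ m t) j)) i
          ≈⟨ subst-linear (suc m) (f 0 * M) 1# (linearMul a b xPower)
                                (λ j → 1# * linearMul g d t j + 1# * yMul (D.∂ m t) j) i ⟩
        (f 0 * M) * subst (suc m) (linearMul a b xPower) i
          + 1# * subst (suc m) (λ j → 1# * linearMul g d t j + 1# * yMul (D.∂ m t) j) i
          ≈⟨ +-congˡ (*-congˡ (subst-linear (suc m) 1# 1# (linearMul g d t) (yMul (D.∂ m t)) i)) ⟩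
        (f 0 * M) * subst (suc m) (linearMul a b xPower) i
          + 1# * (1# * subst (suc m) (linearMul g d t) i + 1# * subst (suc m) (yMul (D.∂ m t)) i)
          ≈⟨ +-cong (*-congˡ (subst-linearMul m a b (xPower-vanishesAbove m) i))
                    (*-congˡ (+-cong (*-congˡ (subst-linearMul m g d (tail-vanishesAbove f↓) i))
                                     (*-congˡ (subst-yMul m (D.∂ m t) i)))) ⟩
        (f 0 * M) * linearMul (a * p + b * r) (a * q + b * s) (subst m xPower) i + 1# * (1# * V + 1# * W)
          ≈⟨ +-congʳ (*-congˡ (linearMul-cong _ _ (subst-xPower m) i)) ⟩
        (f 0 * M) * U + 1# * (1# * V + 1# * W)
          ≈⟨ solve 5 (λ x M U V W → (x :* M) :* U :+ :1 :* (:1 :* V :+ :1 :* W) := x :* (M :* U) :+ :1 :* (V :+ W)) refl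
               (f 0) M U V W ⟩
        f 0 * (M * U) + 1# * (V + W) ∎

  module Inverse (p q r s p′ q′ r′ s′ : Carrier)
    (S′S≈1₁₁ : p′ * p + q′ * r ≈ 1#) (S′S≈1₁₂ : p′ * q + q′ * s ≈ 0#)
    (S′S≈1₂₁ : r′ * p + s′ * r ≈ 0#) (S′S≈1₂₂ : r′ * q + s′ * s ≈ 1#) where
    module S = Substitution p q r s
    module S′ = Substitution p′ q′ r′ s′

    subst-linearPower : ∀ m → S.subst m (S′.linearPower m) ≈ᶠ xPower
    subst-linearPower zero    i = *-identityˡ _
    subst-linearPower (suc m) i = begin
      S.subst (suc m) (linearMul p′ q′ (S′.linearPower m)) i
        ≈⟨ S.subst-linearMul m p′ q′ (S′.linearPower-vanishesAbove m) i ⟩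
      linearMul (p′ * p + q′ * r) (p′ * q + q′ * s) (S.subst m (S′.linearPower m)) i
        ≈⟨ linearMul-congᶜ _ S′S≈1₁₁ S′S≈1₁₂ i ⟩
      linearMul 1# 0# (S.subst m (S′.linearPower m)) i ≈⟨ linearMul-cong 1# 0# (subst-linearPower m) i ⟩
      linearMul 1# 0# xPower i                         ≈⟨ linearMul-x xPower i ⟩
      xPower i                                         ∎

    subst-subst : ∀ m f → VanishesAbove m f → S.subst m (S′.subst m f) ≈ᶠ f
    subst-subst zero f f↓ i = begin
      (f 0 * 1#) * xPower i  ≈⟨ *-congʳ (*-identityʳ _) ⟩
      f 0 * xPower i         ≈⟨ vanishesAbove-0 f↓ i ⟨
      f i                    ∎
    subst-subst (suc m) f f↓ i = begin
      S.subst (suc m) (S′.subst (suc m) f) i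
        ≈⟨ S.subst-cong (suc m) (λ j → +-congˡ {f 0 * S′.linearPower (suc m) j}
                                              (sym (*-identityˡ (linearMul r′ s′ (S′.subst m (tail f)) j)))) i ⟩
      S.subst (suc m) (λ j → f 0 * S′.linearPower (suc m) j + 1# * linearMul r′ s′ (S′.subst m (tail f)) j) i
        ≈⟨ S.subst-linear (suc m) (f 0) 1# (S′.linearPower (suc m)) (linearMul r′ s′ (S′.subst m (tail f))) i ⟩
      f 0 * S.subst (suc m) (S′.linearPower (suc m)) i + 1# * S.subst (suc m) (linearMul r′ s′ (S′.subst m (tail f))) i
        ≈⟨ +-cong (*-congˡ (subst-linearPower (suc m) i))
                  (*-congˡ (S.subst-linearMul m r′ s′ (S′.subst-vanishesAbove m (tail f)) i)) ⟩
      f 0 * xPower i + 1# * linearMul (r′ * p + s′ * r) (r′ * q + s′ * s) (S.subst m (S′.subst m (tail f))) i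
        ≈⟨ +-congˡ (*-congˡ (begin
             linearMul (r′ * p + s′ * r) (r′ * q + s′ * s) (S.subst m (S′.subst m (tail f))) i
               ≈⟨ linearMul-congᶜ _ S′S≈1₂₁ S′S≈1₂₂ i ⟩
             linearMul 0# 1# (S.subst m (S′.subst m (tail f))) i
               ≈⟨ linearMul-cong 0# 1# (subst-subst m (tail f) (tail-vanishesAbove f↓)) i ⟩
             linearMul 0# 1# (tail f) i  ≈⟨ linearMul-y (tail f) i ⟩
             yMul (tail f) i             ∎)) ⟩
      f 0 * xPower i + 1# * yMul (tail f) i ≈⟨ split f i ⟨
      f i ∎

module Coordinates {c ℓ : Level} (R : CommutativeRing c ℓ) where
  open CommutativeRing R hiding (zero)
  open Over R
  open IntegerCoefficientSolver R
  open Forms R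
  open import Relation.Binary.Reasoning.Setoid setoid

  extend : ∀ {k} → Vect k → Form
  extend {zero}  x i       = 0#
  extend {suc k} x zero    = x fz
  extend {suc k} x (suc i) = extend (λ j → x (fs j)) i

  extend-toℕ : ∀ {k} (x : Vect k) j → extend x (toℕ j) ≡ x j
  extend-toℕ x fz     = ≡.refl
  extend-toℕ x (fs j) = extend-toℕ (λ j → x (fs j)) j

  extend-beyond : ∀ {k} (x : Vect k) i → k ≤ i → extend x i ≡ 0#
  extend-beyond {zero}  x i       _         = ≡.refl
  extend-beyond {suc k} x (suc i) (s≤s k≤i) = extend-beyond (λ j → x (fs j)) i k≤i

  extend-vanishesAbove : ∀ {k} (x : Vect (suc k)) → VanishesAbove k (extend x)
  extend-vanishesAbove x i k<i = reflexive (extend-beyond x i k<i)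

  extend-agrees : ∀ {k} (x : Vect k) (f : Form) → (∀ j → x j ≈ f (toℕ j)) → ∀ i → i < k → extend x i ≈ f i
  extend-agrees {suc k} x f x≈f zero    _         = x≈f fz
  extend-agrees {suc k} x f x≈f (suc i) (s≤s i<k) =
    extend-agrees (λ j → x (fs j)) (λ m → f (suc m)) (λ j → x≈f (fs j)) i i<k

  extend-cong : ∀ {k} {x y : Vect k} → x ≋ y → extend x ≈ᶠ extend y
  extend-cong {zero}  x≈y i       = refl
  extend-cong {suc k} x≈y zero    = x≈y fz
  extend-cong {suc k} x≈y (suc i) = extend-cong (λ j → x≈y (fs j)) i

  extend-linear : ∀ {k} k₁ k₂ (x y : Vect k) →
    extend (λ j → k₁ * x j + k₂ * y j) ≈ᶠ λ i → k₁ * extend x i + k₂ * extend y i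
  extend-linear {zero}  k₁ k₂ x y i       = sym (x*0+y*0≈0 k₁ k₂)
  extend-linear {suc k} k₁ k₂ x y zero    = refl
  extend-linear {suc k} k₁ k₂ x y (suc i) = extend-linear k₁ k₂ (λ j → x (fs j)) (λ j → y (fs j)) i

  extend-* : ∀ {k} (h x : Vect k) a m → (∀ j → toℕ j ≡ m → h j ≈ a * x j) → extend h m ≈ a * extend x m
  extend-* {zero}  h x a m       _   = sym (zeroʳ a)
  extend-* {suc k} h x a zero    h≈ax = h≈ax fz ≡.refl
  extend-* {suc k} h x a (suc m) h≈ax =
    extend-* (λ j → h (fs j)) (λ j → x (fs j)) a m (λ j eq → h≈ax (fs j) (≡.cong suc eq))

  sumF-cong : ∀ {k} {f h : Vect k} → f ≋ h → sumF f ≈ sumF h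
  sumF-cong {zero}  f≈h = refl
  sumF-cong {suc k} f≈h = +-cong (f≈h fz) (sumF-cong (λ j → f≈h (fs j)))

  sumF-zero : ∀ {k} (h : Vect k) → (∀ j → h j ≈ 0#) → sumF h ≈ 0#
  sumF-zero {zero}  h h≈0 = refl
  sumF-zero {suc k} h h≈0 = trans (+-cong (h≈0 fz) (sumF-zero (λ j → h (fs j)) (λ j → h≈0 (fs j)))) (+-identityʳ 0#)

  sumF-single : ∀ {k} (h : Vect k) m → (∀ j → toℕ j ≢ m → h j ≈ 0#) → sumF h ≈ extend h m
  sumF-single {zero}  h m       _   = refl
  sumF-single {suc k} h zero    h≈0 = trans (+-congˡ (sumF-zero _ (λ j → h≈0 (fs j) (λ ())))) (+-identityʳ _)
  sumF-single {suc k} h (suc m) h≈0 = begin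
    h fz + sumF (λ j → h (fs j))     ≈⟨ +-cong (h≈0 fz (λ ())) (sumF-single (λ j → h (fs j)) m
                                          (λ j j≢m → h≈0 (fs j) (λ eq → j≢m (ℕ.suc-injective eq)))) ⟩
    0# + extend (λ j → h (fs j)) m   ≈⟨ +-identityˡ _ ⟩
    extend h (suc m)                 ∎

  sumF-* : ∀ {k} a (f : Vect k) → sumF (λ j → a * f j) ≈ a * sumF f
  sumF-* {zero}  a f = sym (zeroʳ a)
  sumF-* {suc k} a f = trans (+-congˡ (sumF-* a (λ j → f (fs j)))) (sym (distribˡ a _ _))

  act-cong : ∀ {k} (M : Mat k) {x y : Vect k} → x ≋ y → act M x ≋ act M y
  act-cong M x≈y i = sumF-cong (λ j → *-congˡ (x≈y j))

  act-* : ∀ {k} (M : Mat k) a (x : Vect k) → act M (λ j → a * x j) ≋ λ i → a * act M x i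
  act-* M a x i = trans (sumF-cong (λ j → x*[y*z]≈y*[x*z] (M i j) a (x j))) (sumF-* a (λ j → M i j * x j))
    where x*[y*z]≈y*[x*z] : ∀ x y z → x * (y * z) ≈ y * (x * z)
          x*[y*z]≈y*[x*z] = solve 3 (λ x y z → x :* (y :* z) := y :* (x :* z)) refl

  δ : ∀ {k} → Fin k → Vect k
  δ j i with toℕ i ≟ toℕ j
  ... | yes _ = 1#
  ... | no _  = 0#

  δ-≢ : ∀ {k} (j i : Fin k) → toℕ i ≢ toℕ j → δ j i ≈ 0#
  δ-≢ j i i≢j with toℕ i ≟ toℕ j
  ... | yes i≡j = ⊥-elim (i≢j i≡j)
  ... | no _    = refl

  δ-≡ : ∀ {k} (j : Fin k) → δ j j ≈ 1#
  δ-≡ j with toℕ j ≟ toℕ j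
  ... | yes _   = refl
  ... | no j≢j  = ⊥-elim (j≢j ≡.refl)

  δ-sym : ∀ {k} (i j : Fin k) → δ j i ≈ δ i j
  δ-sym i j with toℕ i ≟ toℕ j | toℕ j ≟ toℕ i
  ... | yes _   | yes _   = refl
  ... | no _    | no _    = refl
  ... | yes i≡j | no j≢i  = ⊥-elim (j≢i (≡.sym i≡j))
  ... | no i≢j  | yes j≡i = ⊥-elim (i≢j (≡.sym j≡i))

  *δ-toℕ : ∀ {k} (f : ℕ → Carrier) (j i : Fin k) → f (toℕ i) * δ j i ≈ f (toℕ j) * δ j i
  *δ-toℕ f j i with toℕ i ≟ toℕ j
  ... | yes i≡j = *-congʳ (reflexive (≡.cong f i≡j))
  ... | no _    = trans (zeroʳ _) (sym (zeroʳ _))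

  sumF-*δ : ∀ {k} (f : Vect k) j → sumF (λ i → f i * δ j i) ≈ f j
  sumF-*δ f j = begin
    sumF (λ i → f i * δ j i)   ≈⟨ sumF-single _ (toℕ j) (λ i i≢j → trans (*-congˡ (δ-≢ j i i≢j)) (zeroʳ _)) ⟩
    extend (λ i → f i * δ j i) (toℕ j) ≡⟨ extend-toℕ _ j ⟩
    f j * δ j j                ≈⟨ *-congˡ (δ-≡ j) ⟩
    f j * 1#                   ≈⟨ *-identityʳ _ ⟩
    f j                        ∎

  act-δ : ∀ {k} (M : Mat k) j → act M (δ j) ≋ λ i → M i j
  act-δ M j i = sumF-*δ (M i) j

  lincomb-δ : ∀ {k} (a : Vect k) → lincomb a δ ≋ a
  lincomb-δ a i = trans (sumF-cong (λ j → *-congˡ (δ-sym i j))) (sumF-*δ a i)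

  module LinearMap {k} (T : Vect k → Vect k) (T-cong : ∀ {x y} → x ≋ y → T x ≋ T y)
    (T-linear : ∀ a b x y → T (λ i → a * x i + b * y i) ≋ λ i → a * T x i + b * T y i) where

    T-zero : T (λ _ → 0#) ≋ λ _ → 0#
    T-zero i = begin
      T (λ _ → 0#) i                       ≈⟨ T-cong (λ _ → sym (x*0+y*0≈0 0# 0#)) i ⟩
      T (λ _ → 0# * 0# + 0# * 0#) i        ≈⟨ T-linear 0# 0# (λ _ → 0#) (λ _ → 0#) i ⟩
      0# * T (λ _ → 0#) i + 0# * T (λ _ → 0#) i ≈⟨ solve 1 (λ t → :0 :* t :+ :0 :* t := :0) refl _ ⟩
      0#                                   ∎

    T-* : ∀ a x → T (λ i → a * x i) ≋ λ i → a * T x i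
    T-* a x i = begin
      T (λ i → a * x i) i                  ≈⟨ T-cong (λ j → solve 2 (λ a x → a :* x := a :* x :+ :0 :* x) refl a (x j)) i ⟩
      T (λ i → a * x i + 0# * x i) i       ≈⟨ T-linear a 0# x x i ⟩
      a * T x i + 0# * T x i               ≈⟨ solve 2 (λ a t → a :* t :+ :0 :* t := a :* t) refl a _ ⟩
      a * T x i                            ∎

    T-sumF : ∀ {m} (x : Fin m → Vect k) → T (λ i → sumF (λ j → x j i)) ≋ λ i → sumF (λ j → T (x j) i)
    T-sumF {zero}  x i = T-zero i
    T-sumF {suc m} x i = begin
      T (λ i → x fz i + sumF (λ j → x (fs j) i)) i
        ≈⟨ T-cong (λ i′ → solve 2 (λ a b → a :+ b := :1 :* a :+ :1 :* b) refl (x fz i′) (sumF (λ j → x (fs j) i′))) i ⟩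
      T (λ i → 1# * x fz i + 1# * sumF (λ j → x (fs j) i)) i
        ≈⟨ T-linear 1# 1# _ _ i ⟩
      1# * T (x fz) i + 1# * T (λ i → sumF (λ j → x (fs j) i)) i
        ≈⟨ +-congˡ (*-congˡ (T-sumF (λ j → x (fs j)) i)) ⟩
      1# * T (x fz) i + 1# * sumF (λ j → T (x (fs j)) i)
        ≈⟨ solve 2 (λ a b → :1 :* a :+ :1 :* b := a :+ b) refl _ _ ⟩
      T (x fz) i + sumF (λ j → T (x (fs j)) i) ∎

    lincomb-image : ∀ a → lincomb a (λ j → T (δ j)) ≋ T a
    lincomb-image a i = begin
      sumF (λ j → a j * T (δ j) i)         ≈⟨ sumF-cong (λ j → T-* (a j) (δ j) i) ⟨
      sumF (λ j → T (λ i → a j * δ j i) i) ≈⟨ T-sumF (λ j i → a j * δ j i) i ⟨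
      T (λ i → sumF (λ j → a j * δ j i)) i ≈⟨ T-cong (lincomb-δ a) i ⟩
      T a i                                ∎

    image-represents : ∀ (f g : Vect k → Vect k) (M : Mat k) → (∀ x → g (T x) ≋ T (f x)) →
      (∀ j → f (δ j) ≋ λ i → M i j) → Represents (λ j → T (δ j)) g M
    image-represents f g M g∘T≈T∘f fδ≈M j i = begin
      g (T (δ j)) i                         ≈⟨ g∘T≈T∘f (δ j) i ⟩
      T (f (δ j)) i                         ≈⟨ T-cong (fδ≈M j) i ⟩
      T (λ i → M i j) i                     ≈⟨ lincomb-image (λ i → M i j) i ⟨
      lincomb (λ i → M i j) (λ j → T (δ j)) i ∎

  module _ {k} (T T⁻¹ : Vect k → Vect k)
    (T-cong : ∀ {x y} → x ≋ y → T x ≋ T y) (T⁻¹-cong : ∀ {x y} → x ≋ y → T⁻¹ x ≋ T⁻¹ y)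
    (T-linear : ∀ a b x y → T (λ i → a * x i + b * y i) ≋ λ i → a * T x i + b * T y i)
    (T⁻¹-linear : ∀ a b x y → T⁻¹ (λ i → a * x i + b * y i) ≋ λ i → a * T⁻¹ x i + b * T⁻¹ y i)
    (T⁻¹∘T : ∀ x → T⁻¹ (T x) ≋ x) (T∘T⁻¹ : ∀ x → T (T⁻¹ x) ≋ x) where
    open LinearMap T T-cong T-linear using (lincomb-image)

    image-isBasis : IsBasis (λ j → T (δ j))
    image-isBasis = independent , spanning
      where
      independent : ∀ a → lincomb a (λ j → T (δ j)) ≋ (λ _ → 0#) → ∀ j → a j ≈ 0#
      independent a combination≈0 j = begin
        a j                ≈⟨ T⁻¹∘T a j ⟨
        T⁻¹ (T a) j        ≈⟨ T⁻¹-cong (λ i → trans (sym (lincomb-image a i)) (combination≈0 i)) j ⟩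
        T⁻¹ (λ _ → 0#) j   ≈⟨ LinearMap.T-zero T⁻¹ T⁻¹-cong T⁻¹-linear j ⟩
        0#                 ∎
      spanning : ∀ x → Σ (Vect k) (λ a → lincomb a (λ j → T (δ j)) ≋ x)
      spanning x = T⁻¹ x , λ i → trans (lincomb-image (T⁻¹ x) i) (T∘T⁻¹ x i)

binomial : ℕ → ℕ → ℕ
binomial n       zero    = 1
binomial zero    (suc i) = 0
binomial (suc n) (suc i) = binomial n i ℕ.+ binomial n (suc i)

binomial-nonZero : ∀ n i → i ≤ n → Σ ℕ (λ k → binomial n i ≡ suc k)
binomial-nonZero n       zero    _         = 0 , ≡.refl
binomial-nonZero (suc n) (suc i) (s≤s i≤n) with binomial-nonZero n i i≤n
... | k , eq = k ℕ.+ binomial n (suc i) , ≡.cong (ℕ._+ binomial n (suc i)) eq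

module BinomialIdentity {c ℓ : Level} (R : CommutativeRing c ℓ) where
  open CommutativeRing R hiding (zero)
  open Over R using (ι)
  open IntegerCoefficientSolver R
  open NaturalEmbedding R
  open import Relation.Binary.Reasoning.Setoid setoid

  [1+i]C[n,1+i]≈[n-i]C[n,i] : ∀ n i → ι (suc i) * ι (binomial n (suc i)) ≈ (ι n - ι i) * ι (binomial n i)
  [1+i]C[n,1+i]≈[n-i]C[n,i] zero zero =
    solve 0 ((:1 :+ :0) :* :0 := (:0 :- :0) :* (:1 :+ :0)) refl
  [1+i]C[n,1+i]≈[n-i]C[n,i] zero (suc i) =
    solve 1 (λ I → (:1 :+ (:1 :+ I)) :* :0 := (:0 :- (:1 :+ I)) :* :0) refl (ι i)
  [1+i]C[n,1+i]≈[n-i]C[n,i] (suc n) zero = begin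
    ι 1 * ι (suc (binomial n 1))  ≈⟨ solve 1 (λ B → (:1 :+ :0) :* (:1 :+ B)
                                               := :1 :+ (:1 :+ :0) :* B) refl (ι (binomial n 1)) ⟩
    1# + ι 1 * ι (binomial n 1)   ≈⟨ +-congˡ ([1+i]C[n,1+i]≈[n-i]C[n,i] n 0) ⟩
    1# + (ι n - ι 0) * ι 1        ≈⟨ solve 1 (λ N → :1 :+ (N :- :0) :* (:1 :+ :0)
                                               := ((:1 :+ N) :- :0) :* (:1 :+ :0)) refl (ι n) ⟩
    (ι (suc n) - ι 0) * ι 1       ∎
  [1+i]C[n,1+i]≈[n-i]C[n,i] (suc n) (suc i) = begin
    ι (suc (suc i)) * ι (binomial n (suc i) ℕ.+ binomial n (suc (suc i)))
      ≈⟨ *-congˡ (ι-+ (binomial n (suc i)) (binomial n (suc (suc i)))) ⟩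
    ι (suc (suc i)) * (B₁ + B₂)
      ≈⟨ distribˡ _ B₁ B₂ ⟩
    ι (suc (suc i)) * B₁ + ι (suc (suc i)) * B₂
      ≈⟨ +-congˡ ([1+i]C[n,1+i]≈[n-i]C[n,i] n (suc i)) ⟩
    ι (suc (suc i)) * B₁ + (ι n - ι (suc i)) * B₁
      ≈⟨ solve 3 (λ I N B₁ → (:1 :+ (:1 :+ I)) :* B₁ :+ (N :- (:1 :+ I)) :* B₁ := (:1 :+ I) :* B₁ :+ (N :- I) :* B₁) refl
           (ι i) (ι n) B₁ ⟩
    ι (suc i) * B₁ + (ι n - ι i) * B₁
      ≈⟨ +-congʳ ([1+i]C[n,1+i]≈[n-i]C[n,i] n i) ⟩
    (ι n - ι i) * B₀ + (ι n - ι i) * B₁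
      ≈⟨ solve 4 (λ I N B₀ B₁ → (N :- I) :* B₀ :+ (N :- I) :* B₁ := ((:1 :+ N) :- (:1 :+ I)) :* (B₀ :+ B₁)) refl
           (ι i) (ι n) B₀ B₁ ⟩
    (ι (suc n) - ι (suc i)) * (B₀ + B₁)
      ≈⟨ *-congˡ (ι-+ (binomial n i) (binomial n (suc i))) ⟨
    (ι (suc n) - ι (suc i)) * ι (binomial n i ℕ.+ binomial n (suc i)) ∎
    where B₀ = ι (binomial n i)
          B₁ = ι (binomial n (suc i))
          B₂ = ι (binomial n (suc (suc i)))

module Representation {c ℓ : Level} (R : CommutativeRing c ℓ) (F : Over.IsCharZeroField R)
  (ω : CommutativeRing.Carrier R)
  (ω²≉1 : ¬ (CommutativeRing._≈_ R (CommutativeRing._*_ R ω ω) (CommutativeRing.1# R))) (n : ℕ) where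
  open CommutativeRing R hiding (zero)
  open Over R
  open Over.IsCharZeroField F
  open Over.Field R F
  open Over.Field.Module R F n
  open Over.Field.Module.Zeta R F n ω
  open IntegerCoefficientSolver R
  open NaturalEmbedding R
  open Forms R
  open Coordinates R
  open BinomialIdentity R
  open import Relation.Binary.Reasoning.Setoid setoid

  half*2≈1 : half * (1# + 1#) ≈ 1#
  half*2≈1 = trans (*-comm _ _) (inv-r (1# + 1#) (λ 2≈0 → charZero 1 (trans (+-congˡ (+-identityʳ 1#)) 2≈0)))

  1-ω≉0 : ¬ (1# - ω ≈ 0#)
  1-ω≉0 1-ω≈0 = ω²≉1 (begin
    ω * ω                              ≈⟨ solve 1 (λ w → w :* w := (:1 :- (:1 :- w)) :* (:1 :- (:1 :- w))) refl ω ⟩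
    (1# - (1# - ω)) * (1# - (1# - ω))  ≈⟨ *-cong (+-congˡ (-‿cong 1-ω≈0)) (+-congˡ (-‿cong 1-ω≈0)) ⟩
    (1# - 0#) * (1# - 0#)              ≈⟨ solve 0 ((:1 :- :0) :* (:1 :- :0) := :1) refl ⟩
    1#                                 ∎)

  half*[n-2i]≈θ : ∀ i → half * (ι n - ι (2 ℕ.* i)) ≈ θ i
  half*[n-2i]≈θ i = begin
    half * (ι n - ι (2 ℕ.* i))          ≈⟨ *-congˡ (+-congˡ (-‿cong (ι-double i))) ⟩
    half * (ι n - (ι i + ι i))          ≈⟨ solve 3 (λ h N I → h :* (N :- (I :+ I)) := h :* N :- (h :* (:1 :+ :1)) :* I) refl
                                             half (ι n) (ι i) ⟩
    half * ι n - (half * (1# + 1#)) * ι i ≈⟨ +-congˡ (-‿cong (trans (*-congʳ half*2≈1) (*-identityˡ (ι i)))) ⟩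
    θ i                                 ∎

  toℕ≤n : ∀ (j : Fin (suc n)) → toℕ j ≤ n
  toℕ≤n j = ℕ.≤-pred (Fin.toℕ<n j)

  Emat-≡ : ∀ i j → toℕ j ≡ suc (toℕ i) → Emat i j ≡ ι (suc (n ∸ toℕ j))
  Emat-≡ i j eq with toℕ j ≟ suc (toℕ i)
  ... | yes _  = ≡.refl
  ... | no neq = ⊥-elim (neq eq)

  Emat-≢ : ∀ i j → toℕ j ≢ suc (toℕ i) → Emat i j ≡ 0#
  Emat-≢ i j neq with toℕ j ≟ suc (toℕ i)
  ... | yes eq = ⊥-elim (neq eq)
  ... | no _   = ≡.refl

  Fmat-≡ : ∀ i j → toℕ i ≡ suc (toℕ j) → Fmat i j ≡ ι (suc (toℕ j))
  Fmat-≡ i j eq with toℕ i ≟ suc (toℕ j)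
  ... | yes _  = ≡.refl
  ... | no neq = ⊥-elim (neq eq)

  Fmat-≢ : ∀ i j → toℕ i ≢ suc (toℕ j) → Fmat i j ≡ 0#
  Fmat-≢ i j neq with toℕ i ≟ suc (toℕ j)
  ... | yes eq = ⊥-elim (neq eq)
  ... | no _   = ≡.refl

  Hmat-≡ : ∀ i j → toℕ i ≡ toℕ j → Hmat i j ≡ ι n - ι (2 ℕ.* toℕ j)
  Hmat-≡ i j eq with toℕ i ≟ toℕ j
  ... | yes _  = ≡.refl
  ... | no neq = ⊥-elim (neq eq)

  Hmat-≢ : ∀ i j → toℕ i ≢ toℕ j → Hmat i j ≡ 0#
  Hmat-≢ i j neq with toℕ i ≟ toℕ j
  ... | yes eq = ⊥-elim (neq eq)
  ... | no _   = ≡.refl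

  private
    ≡0⇒*≈0 : ∀ {a} b → a ≡ 0# → a * b ≈ 0#
    ≡0⇒*≈0 b ≡.refl = zeroˡ b

  act-Emat : ∀ x i → act Emat x i ≈ ι (suc (n ∸ suc (toℕ i))) * extend x (suc (toℕ i))
  act-Emat x i = trans (sumF-single _ (suc (toℕ i)) (λ j neq → ≡0⇒*≈0 (x j) (Emat-≢ i j neq)))
    (extend-* _ x _ (suc (toℕ i))
      (λ j eq → *-congʳ (reflexive (≡.trans (Emat-≡ i j eq) (≡.cong (λ t → ι (suc (n ∸ t))) eq)))))

  act-Fmat : ∀ x i → act Fmat x i ≈ ι (toℕ i) * extend x (ℕ.pred (toℕ i))
  act-Fmat x fz     = trans (sumF-zero _ (λ j → ≡0⇒*≈0 (x j) (Fmat-≢ fz j (λ ())))) (sym (zeroˡ _))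
  act-Fmat x (fs i) = trans
    (sumF-single _ (toℕ i) (λ j neq → ≡0⇒*≈0 (x j) (Fmat-≢ (fs i) j (λ eq → neq (≡.sym (ℕ.suc-injective eq))))))
    (extend-* _ x _ (toℕ i)
      (λ j eq → *-congʳ (reflexive (≡.trans (Fmat-≡ (fs i) j (≡.cong suc (≡.sym eq))) (≡.cong (λ t → ι (suc t)) eq)))))

  act-Hmat : ∀ x i → act Hmat x i ≈ (ι n - ι (2 ℕ.* toℕ i)) * x i
  act-Hmat x i = trans (sumF-single _ (toℕ i) (λ j neq → ≡0⇒*≈0 (x j) (Hmat-≢ i j (λ eq → neq (≡.sym eq)))))
    (trans (extend-* _ x _ (toℕ i)
             (λ j eq → *-congʳ (reflexive (≡.trans (Hmat-≡ i j (≡.sym eq)) (≡.cong (λ t → ι n - ι (2 ℕ.* t)) eq)))))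
           (*-congˡ (reflexive (extend-toℕ x i))))

  -- toForm x is Σᵢ xᵢ vᵢ for vᵢ = (n choose i) xⁿ⁻ⁱ yⁱ, on which E = x∂ᵧ, F = y∂ₓ and H = x∂ₓ − y∂ᵧ.
  binom : ℕ → Carrier
  binom i = ι (binomial n i)

  toForm : Vect (suc n) → Form
  toForm x i = binom i * extend x i

  toForm-vanishesAbove : ∀ x → VanishesAbove n (toForm x)
  toForm-vanishesAbove x i n<i = trans (*-congˡ (extend-vanishesAbove x i n<i)) (zeroʳ _)

  toForm-cong : ∀ {x y} → x ≋ y → toForm x ≈ᶠ toForm y
  toForm-cong x≈y i = *-congˡ (extend-cong x≈y i)

  toForm-linear : ∀ k₁ k₂ x y → toForm (λ j → k₁ * x j + k₂ * y j) ≈ᶠ λ i → k₁ * toForm x i + k₂ * toForm y i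
  toForm-linear k₁ k₂ x y i = trans (*-congˡ (extend-linear k₁ k₂ x y i))
    (solve 5 (λ b k₁ k₂ a c → b :* (k₁ :* a :+ k₂ :* c) := k₁ :* (b :* a) :+ k₂ :* (b :* c)) refl
       (binom i) k₁ k₂ (extend x i) (extend y i))

  binom*inv≈1 : ∀ i → i ≤ n → binom i * inv (binom i) ≈ 1#
  binom*inv≈1 i i≤n with binomial-nonZero n i i≤n
  ... | k , eq rewrite eq = inv-r (ι (suc k)) (charZero k)

  fromForm : Form → Vect (suc n)
  fromForm f j = inv (binom (toℕ j)) * f (toℕ j)

  fromForm-cong : ∀ {f h} → f ≈ᶠ h → fromForm f ≋ fromForm h
  fromForm-cong f≈h j = *-congˡ (f≈h (toℕ j))

  fromForm-linear : ∀ k₁ k₂ f h → fromForm (λ i → k₁ * f i + k₂ * h i) ≋ λ j → k₁ * fromForm f j + k₂ * fromForm h j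
  fromForm-linear k₁ k₂ f h j = solve 5 (λ v k₁ k₂ a b → v :* (k₁ :* a :+ k₂ :* b) := k₁ :* (v :* a) :+ k₂ :* (v :* b)) refl
    (inv (binom (toℕ j))) k₁ k₂ (f (toℕ j)) (h (toℕ j))

  fromForm-toForm : ∀ x → fromForm (toForm x) ≋ x
  fromForm-toForm x j = begin
    inv (binom (toℕ j)) * (binom (toℕ j) * extend x (toℕ j))
      ≈⟨ solve 3 (λ a b e → a :* (b :* e) := (b :* a) :* e) refl _ _ _ ⟩
    (binom (toℕ j) * inv (binom (toℕ j))) * extend x (toℕ j)
      ≈⟨ *-congʳ (binom*inv≈1 (toℕ j) (toℕ≤n j)) ⟩
    1# * extend x (toℕ j)  ≈⟨ *-identityˡ _ ⟩
    extend x (toℕ j)       ≡⟨ extend-toℕ x j ⟩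
    x j                    ∎

  toForm-fromForm : ∀ f → VanishesAbove n f → toForm (fromForm f) ≈ᶠ f
  toForm-fromForm f f↓ i with i ℕ.≤? n
  ... | yes i≤n = begin
    binom i * extend (fromForm f) i
      ≈⟨ *-congˡ (extend-agrees (fromForm f) (λ i → inv (binom i) * f i) (λ _ → refl) i (s≤s i≤n)) ⟩
    binom i * (inv (binom i) * f i)         ≈⟨ *-assoc _ _ _ ⟨
    (binom i * inv (binom i)) * f i         ≈⟨ *-congʳ (binom*inv≈1 i i≤n) ⟩
    1# * f i                                ≈⟨ *-identityˡ _ ⟩
    f i                                     ∎
  ... | no i≰n = trans (toForm-vanishesAbove (fromForm f) i (ℕ.≰⇒> i≰n)) (sym (f↓ i (ℕ.≰⇒> i≰n)))

  aᴬ bᴬ gᴬ dᴬ aᴮ bᴮ gᴮ dᴮ : Carrier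
  aᴬ = - (half * ω)
  bᴬ = half * (1# - ω)
  gᴬ = half * (1# + ω)
  dᴬ = half * ω
  aᴮ = half
  bᴮ = 0#
  gᴮ = 0#
  dᴮ = - half

  module ∂A = Derivation aᴬ bᴬ gᴬ dᴬ
  module ∂B = Derivation aᴮ bᴮ gᴮ dᴮ

  Aopᶠ : Vect (suc n) → Form
  Aopᶠ x i = half * (1# + ω) * (ι (suc (n ∸ suc i)) * extend x (suc i))
           + half * (1# - ω) * (ι i * extend x (ℕ.pred i))
           - half * ω * ((ι n - ι (2 ℕ.* i)) * extend x i)

  act-Hmat-extend : ∀ x j → act Hmat x j ≈ (ι n - ι (2 ℕ.* toℕ j)) * extend x (toℕ j)
  act-Hmat-extend x j = trans (act-Hmat x j) (*-congˡ (reflexive (≡.sym (extend-toℕ x j))))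

  Aop≈Aopᶠ : ∀ x j → Aop x j ≈ Aopᶠ x (toℕ j)
  Aop≈Aopᶠ x j = +-cong (+-cong (*-congˡ (act-Emat x j)) (*-congˡ (act-Fmat x j))) (-‿cong (*-congˡ (act-Hmat-extend x j)))

  binom-raising : ∀ x i → i ≤ n → binom i * (ι (suc (n ∸ suc i)) * extend x (suc i)) ≈ ι (suc i) * toForm x (suc i)
  binom-raising x i i≤n with ℕ.m≤n⇒m<n∨m≡n i≤n
  ... | inj₁ i<n = begin
    binom i * (ι (suc (n ∸ suc i)) * extend x (suc i))
      ≡⟨ ≡.cong (λ t → binom i * (ι t * extend x (suc i))) (ℕ.+-∸-assoc 1 i<n) ⟨
    binom i * (ι (n ∸ i) * extend x (suc i))           ≈⟨ *-congˡ (*-congʳ (ι-∸ i≤n)) ⟩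
    binom i * ((ι n - ι i) * extend x (suc i))         ≈⟨ solve 3 (λ b c e → b :* (c :* e) := (c :* b) :* e) refl _ _ _ ⟩
    ((ι n - ι i) * binom i) * extend x (suc i)         ≈⟨ *-congʳ ([1+i]C[n,1+i]≈[n-i]C[n,i] n i) ⟨
    (ι (suc i) * binom (suc i)) * extend x (suc i)     ≈⟨ *-assoc _ _ _ ⟩
    ι (suc i) * toForm x (suc i)                       ∎
  ... | inj₂ ≡.refl = begin
    binom i * (ι (suc (n ∸ suc i)) * extend x (suc i)) ≈⟨ *-congˡ (*-congˡ (extend-vanishesAbove x (suc i) ℕ.≤-refl)) ⟩
    binom i * (ι (suc (n ∸ suc i)) * 0#)               ≈⟨ solve 3 (λ a b c → a :* (b :* :0) := c :* :0) refl _ _ _ ⟩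
    ι (suc i) * 0#                                     ≈⟨ *-congˡ (toForm-vanishesAbove x (suc i) ℕ.≤-refl) ⟨
    ι (suc i) * toForm x (suc i)                       ∎

  binom-lowering : ∀ x i → binom (suc i) * (ι (suc i) * extend x i) ≈ (ι n - ι i) * toForm x i
  binom-lowering x i = begin
    binom (suc i) * (ι (suc i) * extend x i)   ≈⟨ solve 3 (λ b c e → b :* (c :* e) := (c :* b) :* e) refl _ _ _ ⟩
    (ι (suc i) * binom (suc i)) * extend x i   ≈⟨ *-congʳ ([1+i]C[n,1+i]≈[n-i]C[n,i] n i) ⟩
    ((ι n - ι i) * binom i) * extend x i       ≈⟨ *-assoc _ _ _ ⟩
    (ι n - ι i) * toForm x i                   ∎

  binom*Aopᶠ : ∀ x i → i ≤ n → binom i * Aopᶠ x i ≈ ∂A.∂ n (toForm x) i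
  binom*Aopᶠ x zero i≤n = begin
    binom 0 * (h1+ω * (ι (suc (n ∸ 1)) * extend x 1) + h1-ω * (0# * extend x 0) - hω * ((ι n - 0#) * extend x 0))
      ≈⟨ solve 7 (λ h w b E e₀ N X → b :* (h :* (:1 :+ w) :* (X :* E) :+ h :* (:1 :- w) :* (:0 :* e₀) :- h :* w :* ((N :- :0) :* e₀))
                  := h :* (:1 :+ w) :* (b :* (X :* E)) :- h :* w :* (b :* ((N :- :0) :* e₀))) refl
           half ω (binom 0) (extend x 1) (extend x 0) (ι n) (ι (suc (n ∸ 1))) ⟩
    h1+ω * (binom 0 * (ι (suc (n ∸ 1)) * extend x 1)) - hω * (binom 0 * ((ι n - 0#) * extend x 0))
      ≈⟨ +-congʳ (*-congˡ (binom-raising x 0 i≤n)) ⟩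
    h1+ω * (ι 1 * toForm x 1) - hω * (binom 0 * ((ι n - 0#) * extend x 0))
      ≈⟨ solve 6 (λ h w b N e₀ f₁ → h :* (:1 :+ w) :* ((:1 :+ :0) :* f₁) :- h :* w :* (b :* ((N :- :0) :* e₀))
                 
                    := ((N :- :0) :* (:- (h :* w)) :+ :0 :* (h :* w)) :* (b :* e₀) :+ (:1 :+ :0) :* (h :* (:1 :+ w)) :* f₁) refl
           half ω (binom 0) (ι n) (extend x 0) (toForm x 1) ⟩
    ∂A.∂ n (toForm x) 0 ∎
    where h1+ω = half * (1# + ω)
          h1-ω = half * (1# - ω)
          hω   = half * ω
  binom*Aopᶠ x (suc i) i≤n = begin
    binom (suc i) * (h1+ω * E + h1-ω * (ι (suc i) * extend x i) - hω * ((ι n - T) * extend x (suc i)))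
      ≈⟨ solve 8 (λ h w b E F N T e → b :* (h :* (:1 :+ w) :* E :+ h :* (:1 :- w) :* F :- h :* w :* ((N :- T) :* e))
                  := h :* (:1 :+ w) :* (b :* E) :+ h :* (:1 :- w) :* (b :* F) :- h :* w :* (b :* ((N :- T) :* e))) refl
                  half ω (binom (suc i)) E (ι (suc i) * extend x i) (ι n) T (extend x (suc i)) ⟩
    h1+ω * (binom (suc i) * E) + h1-ω * (binom (suc i) * (ι (suc i) * extend x i))
      - hω * (binom (suc i) * ((ι n - T) * extend x (suc i)))
      ≈⟨ +-cong (+-cong (*-congˡ (binom-raising x (suc i) i≤n)) (*-congˡ (binom-lowering x i)))
                (-‿cong (*-congˡ (*-congˡ (*-congʳ (+-congˡ (-‿cong (ι-double (suc i)))))))) ⟩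
    h1+ω * (ι (suc (suc i)) * toForm x (suc (suc i))) + h1-ω * ((ι n - ι i) * toForm x i)
      - hω * (binom (suc i) * ((ι n - (ι (suc i) + ι (suc i))) * extend x (suc i)))
      ≈⟨ solve 8 (λ h w I N b₁ e₁ f₀ f₂ →
           h :* (:1 :+ w) :* ((:1 :+ (:1 :+ I)) :* f₂) :+ h :* (:1 :- w) :* ((N :- I) :* f₀)
             :- h :* w :* (b₁ :* ((N :- ((:1 :+ I) :+ (:1 :+ I))) :* e₁))
           := ((N :- (:1 :+ I)) :* (:- (h :* w)) :+ (:1 :+ I) :* (h :* w)) :* (b₁ :* e₁)
              :+ (N :- I) :* (h :* (:1 :- w)) :* f₀ :+ (:1 :+ (:1 :+ I)) :* (h :* (:1 :+ w)) :* f₂) refl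
           half ω (ι i) (ι n) (binom (suc i)) (extend x (suc i)) (toForm x i) (toForm x (suc (suc i))) ⟩
    ∂A.∂ n (toForm x) (suc i) ∎
    where h1+ω = half * (1# + ω)
          h1-ω = half * (1# - ω)
          hω   = half * ω
          E    = ι (suc (n ∸ suc (suc i))) * extend x (suc (suc i))
          T    = ι (2 ℕ.* suc i)

  Bopᶠ : Vect (suc n) → Form
  Bopᶠ x i = half * ((ι n - ι (2 ℕ.* i)) * extend x i)

  binom*Bopᶠ : ∀ x i → binom i * Bopᶠ x i ≈ ∂B.∂ n (toForm x) i
  binom*Bopᶠ x zero = solve 5 (λ h b N e₀ f₁ → b :* (h :* ((N :- :0) :* e₀))
      := ((N :- :0) :* h :+ :0 :* (:- h)) :* (b :* e₀) :+ (:1 :+ :0) :* :0 :* f₁) refl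
    half (binom 0) (ι n) (extend x 0) (toForm x 1)
  binom*Bopᶠ x (suc i) = begin
    binom (suc i) * (half * ((ι n - ι (2 ℕ.* suc i)) * extend x (suc i)))
      ≈⟨ *-congˡ (*-congˡ (*-congʳ (+-congˡ (-‿cong (ι-double (suc i)))))) ⟩
    binom (suc i) * (half * ((ι n - (ι (suc i) + ι (suc i))) * extend x (suc i)))
      ≈⟨ solve 7 (λ h b I N e f₀ f₂ → b :* (h :* ((N :- ((:1 :+ I) :+ (:1 :+ I))) :* e))
          
             := ((N :- (:1 :+ I)) :* h :+ (:1 :+ I) :* (:- h)) :* (b :* e) :+ (N :- I) :* :0 :* f₀ :+ (:1 :+ (:1 :+ I)) :* :0 :* f₂) refl
           half (binom (suc i)) (ι i) (ι n) (extend x (suc i)) (toForm x i) (toForm x (suc (suc i))) ⟩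
    ∂B.∂ n (toForm x) (suc i) ∎

  toForm-Aop : ∀ x → toForm (Aop x) ≈ᶠ ∂A.∂ n (toForm x)
  toForm-Aop x i with i ℕ.≤? n
  ... | yes i≤n = trans (*-congˡ (extend-agrees (Aop x) (Aopᶠ x) (Aop≈Aopᶠ x) i (s≤s i≤n))) (binom*Aopᶠ x i i≤n)
  ... | no i≰n  = trans (toForm-vanishesAbove (Aop x) i (ℕ.≰⇒> i≰n))
                        (sym (∂A.∂-vanishesAbove n (toForm-vanishesAbove x) i (ℕ.≰⇒> i≰n)))

  toForm-Bop : ∀ x → toForm (Bop x) ≈ᶠ ∂B.∂ n (toForm x)
  toForm-Bop x i with i ℕ.≤? n
  ... | yes i≤n = trans (*-congˡ (extend-agrees (Bop x) (Bopᶠ x) (λ j → *-congˡ (act-Hmat-extend x j)) i (s≤s i≤n)))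
                        (binom*Bopᶠ x i)
  ... | no i≰n  = trans (toForm-vanishesAbove (Bop x) i (ℕ.≰⇒> i≰n))
                        (sym (∂B.∂-vanishesAbove n (toForm-vanishesAbove x) i (ℕ.≰⇒> i≰n)))

  s₁₁ s₁₂ s₂₁ s₂₂ κ : Carrier
  s₁₁ = 1# - ω
  s₁₂ = 1# - ω
  s₂₁ = 1# + ω
  s₂₂ = - (1# - ω)
  κ   = half * inv (1# - ω)

  S²₁₁ : s₁₁ * s₁₁ + s₁₂ * s₂₁ ≈ (1# + 1#) * (1# - ω)
  S²₁₁ = solve 1 (λ w → (:1 :- w) :* (:1 :- w) :+ (:1 :- w) :* (:1 :+ w) := (:1 :+ :1) :* (:1 :- w)) refl ω

  S²₁₂ : s₁₁ * s₁₂ + s₁₂ * s₂₂ ≈ 0#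
  S²₁₂ = solve 1 (λ w → (:1 :- w) :* (:1 :- w) :+ (:1 :- w) :* (:- (:1 :- w)) := :0) refl ω

  S²₂₁ : s₂₁ * s₁₁ + s₂₂ * s₂₁ ≈ 0#
  S²₂₁ = solve 1 (λ w → (:1 :+ w) :* (:1 :- w) :+ (:- (:1 :- w)) :* (:1 :+ w) := :0) refl ω

  S²₂₂ : s₂₁ * s₁₂ + s₂₂ * s₂₂ ≈ (1# + 1#) * (1# - ω)
  S²₂₂ = solve 1 (λ w → (:1 :+ w) :* (:1 :- w) :+ (:- (:1 :- w)) :* (:- (:1 :- w)) := (:1 :+ :1) :* (:1 :- w)) refl ω

  κ*2[1-ω]≈1 : κ * ((1# + 1#) * (1# - ω)) ≈ 1#
  κ*2[1-ω]≈1 = begin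
    κ * ((1# + 1#) * (1# - ω))
      ≈⟨ solve 3 (λ h v w → (h :* v) :* ((:1 :+ :1) :* w)
                   := (h :* (:1 :+ :1)) :* (w :* v)) refl half (inv (1# - ω)) (1# - ω) ⟩
    (half * (1# + 1#)) * ((1# - ω) * inv (1# - ω))  ≈⟨ *-cong half*2≈1 (inv-r (1# - ω) 1-ω≉0) ⟩
    1# * 1#                                         ≈⟨ *-identityˡ 1# ⟩
    1#                                              ∎

  κ-scaledˡ : ∀ {a b c d t} → a * b + c * d ≈ t → (κ * a) * b + (κ * c) * d ≈ κ * t
  κ-scaledˡ {a} {b} {c} {d} ≈t =
    trans (solve 5 (λ k a b c d → (k :* a) :* b :+ (k :* c) :* d := k :* (a :* b :+ c :* d)) refl κ a b c d) (*-congˡ ≈t)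

  κ-scaledʳ : ∀ {a b c d t} → a * b + c * d ≈ t → a * (κ * b) + c * (κ * d) ≈ κ * t
  κ-scaledʳ {a} {b} {c} {d} ≈t =
    trans (solve 5 (λ k a b c d → a :* (k :* b) :+ c :* (k :* d) := k :* (a :* b :+ c :* d)) refl κ a b c d) (*-congˡ ≈t)

  module S = Substitution s₁₁ s₁₂ s₂₁ s₂₂
  module S⁻¹ = Substitution (κ * s₁₁) (κ * s₁₂) (κ * s₂₁) (κ * s₂₂)

  module S∘S⁻¹ = Inverse s₁₁ s₁₂ s₂₁ s₂₂ (κ * s₁₁) (κ * s₁₂) (κ * s₂₁) (κ * s₂₂)
    (trans (κ-scaledˡ S²₁₁) κ*2[1-ω]≈1) (trans (κ-scaledˡ S²₁₂) (zeroʳ κ))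
    (trans (κ-scaledˡ S²₂₁) (zeroʳ κ))  (trans (κ-scaledˡ S²₂₂) κ*2[1-ω]≈1)

  module S⁻¹∘S = Inverse (κ * s₁₁) (κ * s₁₂) (κ * s₂₁) (κ * s₂₂) s₁₁ s₁₂ s₂₁ s₂₂
    (trans (κ-scaledʳ S²₁₁) κ*2[1-ω]≈1) (trans (κ-scaledʳ S²₁₂) (zeroʳ κ))
    (trans (κ-scaledʳ S²₂₁) (zeroʳ κ))  (trans (κ-scaledʳ S²₂₂) κ*2[1-ω]≈1)

  module ∂A∘S = Intertwining aᴮ bᴮ gᴮ dᴮ aᴬ bᴬ gᴬ dᴬ s₁₁ s₁₂ s₂₁ s₂₂
    (solve 2 (λ h w → (:1 :- w) :* (:- (h :* w)) :+ (:1 :- w) :* (h :* (:1 :+ w))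
               := h :* (:1 :- w) :+ :0 :* (:1 :+ w)) refl half ω)
    (solve 2 (λ h w → (:1 :- w) :* (h :* (:1 :- w)) :+ (:1 :- w) :* (h :* w)
               := h :* (:1 :- w) :+ :0 :* (:- (:1 :- w))) refl half ω)
    (solve 2 (λ h w → (:1 :+ w) :* (:- (h :* w)) :+ (:- (:1 :- w)) :* (h :* (:1 :+ w))
               := :0 :* (:1 :- w) :+ (:- h) :* (:1 :+ w)) refl half ω)
    (solve 2 (λ h w → (:1 :+ w) :* (h :* (:1 :- w)) :+ (:- (:1 :- w)) :* (h :* w)
               := :0 :* (:1 :- w) :+ (:- h) :* (:- (:1 :- w))) refl half ω)

  module ∂B∘S = Intertwining aᴬ bᴬ gᴬ dᴬ aᴮ bᴮ gᴮ dᴮ s₁₁ s₁₂ s₂₁ s₂₂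
    (solve 2 (λ h w → (:1 :- w) :* h :+ (:1 :- w) :* :0
               := (:- (h :* w)) :* (:1 :- w) :+ (h :* (:1 :- w)) :* (:1 :+ w)) refl half ω)
    (solve 2 (λ h w → (:1 :- w) :* :0 :+ (:1 :- w) :* (:- h)
               := (:- (h :* w)) :* (:1 :- w) :+ (h :* (:1 :- w)) :* (:- (:1 :- w))) refl half ω)
    (solve 2 (λ h w → (:1 :+ w) :* h :+ (:- (:1 :- w)) :* :0
               := (h :* (:1 :+ w)) :* (:1 :- w) :+ (h :* w) :* (:1 :+ w)) refl half ω)
    (solve 2 (λ h w → (:1 :+ w) :* :0 :+ (:- (:1 :- w)) :* (:- h)
               := (h :* (:1 :+ w)) :* (:1 :- w) :+ (h :* w) :* (:- (:1 :- w))) refl half ω)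

  G G⁻¹ : Vect (suc n) → Vect (suc n)
  G   x = fromForm (S.subst n (toForm x))
  G⁻¹ x = fromForm (S⁻¹.subst n (toForm x))

  G-cong : ∀ {x y} → x ≋ y → G x ≋ G y
  G-cong x≈y = fromForm-cong (S.subst-cong n (toForm-cong x≈y))

  G⁻¹-cong : ∀ {x y} → x ≋ y → G⁻¹ x ≋ G⁻¹ y
  G⁻¹-cong x≈y = fromForm-cong (S⁻¹.subst-cong n (toForm-cong x≈y))

  G-linear : ∀ k₁ k₂ x y → G (λ i → k₁ * x i + k₂ * y i) ≋ λ i → k₁ * G x i + k₂ * G y i
  G-linear k₁ k₂ x y i = trans
    (fromForm-cong (≈ᶠ-trans (S.subst-cong n (toForm-linear k₁ k₂ x y))
                             (S.subst-linear n k₁ k₂ (toForm x) (toForm y))) i)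
    (fromForm-linear k₁ k₂ (S.subst n (toForm x)) (S.subst n (toForm y)) i)

  G⁻¹-linear : ∀ k₁ k₂ x y → G⁻¹ (λ i → k₁ * x i + k₂ * y i) ≋ λ i → k₁ * G⁻¹ x i + k₂ * G⁻¹ y i
  G⁻¹-linear k₁ k₂ x y i = trans
    (fromForm-cong (≈ᶠ-trans (S⁻¹.subst-cong n (toForm-linear k₁ k₂ x y))
                             (S⁻¹.subst-linear n k₁ k₂ (toForm x) (toForm y))) i)
    (fromForm-linear k₁ k₂ (S⁻¹.subst n (toForm x)) (S⁻¹.subst n (toForm y)) i)

  G∘G⁻¹ : ∀ x → G (G⁻¹ x) ≋ x
  G∘G⁻¹ x j = begin
    G (G⁻¹ x) j                              ≈⟨ fromForm-cong (S.subst-cong n (toForm-fromForm _ (S⁻¹.subst-vanishesAbove n (toForm x)))) j ⟩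
    fromForm (S.subst n (S⁻¹.subst n (toForm x))) j ≈⟨ fromForm-cong (S∘S⁻¹.subst-subst n (toForm x) (toForm-vanishesAbove x)) j ⟩
    fromForm (toForm x) j                    ≈⟨ fromForm-toForm x j ⟩
    x j                                      ∎

  G⁻¹∘G : ∀ x → G⁻¹ (G x) ≋ x
  G⁻¹∘G x j = begin
    G⁻¹ (G x) j                              ≈⟨ fromForm-cong (S⁻¹.subst-cong n (toForm-fromForm _ (S.subst-vanishesAbove n (toForm x)))) j ⟩
    fromForm (S⁻¹.subst n (S.subst n (toForm x))) j ≈⟨ fromForm-cong (S⁻¹∘S.subst-subst n (toForm x) (toForm-vanishesAbove x)) j ⟩
    fromForm (toForm x) j                    ≈⟨ fromForm-toForm x j ⟩
    x j                                      ∎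

  Aop∘G : ∀ x → Aop (G x) ≋ G (Bop x)
  Aop∘G x j = begin
    Aop (G x) j                                 ≈⟨ fromForm-toForm (Aop (G x)) j ⟨
    fromForm (toForm (Aop (G x))) j             ≈⟨ fromForm-cong (toForm-Aop (G x)) j ⟩
    fromForm (∂A.∂ n (toForm (G x))) j          ≈⟨ fromForm-cong (∂A.∂-cong n (toForm-fromForm _ (S.subst-vanishesAbove n (toForm x)))) j ⟩
    fromForm (∂A.∂ n (S.subst n (toForm x))) j  ≈⟨ fromForm-cong (∂A∘S.∂′-subst n (toForm x) (toForm-vanishesAbove x)) j ⟩
    fromForm (S.subst n (∂B.∂ n (toForm x))) j  ≈⟨ fromForm-cong (S.subst-cong n (≈ᶠ-sym (toForm-Bop x))) j ⟩
    G (Bop x) j                                 ∎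

  Bop∘G : ∀ x → Bop (G x) ≋ G (Aop x)
  Bop∘G x j = begin
    Bop (G x) j                                 ≈⟨ fromForm-toForm (Bop (G x)) j ⟨
    fromForm (toForm (Bop (G x))) j             ≈⟨ fromForm-cong (toForm-Bop (G x)) j ⟩
    fromForm (∂B.∂ n (toForm (G x))) j          ≈⟨ fromForm-cong (∂B.∂-cong n (toForm-fromForm _ (S.subst-vanishesAbove n (toForm x)))) j ⟩
    fromForm (∂B.∂ n (S.subst n (toForm x))) j  ≈⟨ fromForm-cong (∂B∘S.∂′-subst n (toForm x) (toForm-vanishesAbove x)) j ⟩
    fromForm (S.subst n (∂A.∂ n (toForm x))) j  ≈⟨ fromForm-cong (S.subst-cong n (≈ᶠ-sym (toForm-Aop x))) j ⟩
    G (Aop x) j                                 ∎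

  Bop-diagonal : ∀ x i → Bop x i ≈ θ (toℕ i) * x i
  Bop-diagonal x i = begin
    half * act Hmat x i                       ≈⟨ *-congˡ (act-Hmat x i) ⟩
    half * ((ι n - ι (2 ℕ.* toℕ i)) * x i)    ≈⟨ *-assoc _ _ _ ⟨
    half * (ι n - ι (2 ℕ.* toℕ i)) * x i      ≈⟨ *-congʳ (half*[n-2i]≈θ (toℕ i)) ⟩
    θ (toℕ i) * x i                           ∎

  DA≈θ*δ : ∀ i j → DA i j ≈ θ (toℕ j) * δ j i
  DA≈θ*δ i j with toℕ i ≟ toℕ j
  ... | yes _ = sym (*-identityʳ _)
  ... | no _  = sym (zeroʳ _)

  Bop-δ : ∀ j → Bop (δ j) ≋ λ i → DA i j
  Bop-δ j i = trans (Bop-diagonal (δ j) i) (trans (*δ-toℕ θ j i) (sym (DA≈θ*δ i j)))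

  m≡1+n⇒n≢1+m : ∀ {m n} → m ≡ suc n → n ≢ suc m
  m≡1+n⇒n≢1+m m≡1+n n≡1+m = ℕ.<-asym (ℕ.≤-reflexive (≡.sym m≡1+n)) (ℕ.≤-reflexive (≡.sym n≡1+m))

  TB-entry : ∀ i j → half * (1# + ω) * Emat i j + half * (1# - ω) * Fmat i j - half * ω * Hmat i j ≈ TB i j
  TB-entry i j with toℕ i ≟ toℕ j | toℕ i ≟ suc (toℕ j) | suc (toℕ i) ≟ toℕ j
  ... | yes i≡j | yes i≡1+j | _ = ⊥-elim (ℕ.1+n≢n (≡.trans (≡.sym i≡1+j) i≡j))
  ... | yes i≡j | no _ | _ rewrite Emat-≢ i j (λ j≡1+i → ℕ.1+n≢n (≡.trans (≡.sym j≡1+i) (≡.sym i≡j))) =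
    solve 4 (λ h w N T → h :* (:1 :+ w) :* :0 :+ h :* (:1 :- w) :* :0 :- h :* w :* (N :- T) := h :* ((T :- N) :* w)) refl
      half ω (ι n) (ι (2 ℕ.* toℕ j))
  ... | no _ | yes i≡1+j | _ rewrite Emat-≢ i j (m≡1+n⇒n≢1+m i≡1+j) =
    solve 3 (λ h w S → h :* (:1 :+ w) :* :0 :+ h :* (:1 :- w) :* S :- h :* w :* :0 := h :* (S :* (:1 :- w))) refl
      half ω (ι (suc (toℕ j)))
  ... | no _ | no _ | yes 1+i≡j rewrite Emat-≡ i j (≡.sym 1+i≡j) =
    solve 3 (λ h w S → h :* (:1 :+ w) :* S :+ h :* (:1 :- w) :* :0 :- h :* w :* :0 := h :* (S :* (:1 :+ w))) refl
      half ω (ι (suc (n ∸ toℕ j)))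
  ... | no _ | no _ | no 1+i≢j rewrite Emat-≢ i j (λ j≡1+i → 1+i≢j (≡.sym j≡1+i)) =
    solve 2 (λ h w → h :* (:1 :+ w) :* :0 :+ h :* (:1 :- w) :* :0 :- h :* w :* :0 := :0) refl half ω

  Aop-δ : ∀ j → Aop (δ j) ≋ λ i → TB i j
  Aop-δ j i = trans (+-cong (+-cong (*-congˡ (act-δ Emat j i)) (*-congˡ (act-δ Fmat j i))) (-‿cong (*-congˡ (act-δ Hmat j i))))
                    (TB-entry i j)

  TC-entry : ∀ i j → θ (toℕ i) * TB i j - θ (toℕ j) * TB i j ≈ TC i j
  TC-entry i j with toℕ i ≟ toℕ j | toℕ i ≟ suc (toℕ j) | suc (toℕ i) ≟ toℕ j
  ... | yes i≡j | yes i≡1+j | _         = ⊥-elim (ℕ.1+n≢n (≡.trans (≡.sym i≡1+j) i≡j))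
  ... | yes i≡j | no _      | yes 1+i≡j = ⊥-elim (ℕ.1+n≢n (≡.trans 1+i≡j (≡.sym i≡j)))
  ... | yes i≡j | no _      | no _      =
    trans (+-congʳ (*-congʳ (reflexive (≡.cong θ i≡j)))) (-‿inverseʳ _)
  ... | no _    | yes i≡1+j | yes 1+i≡j = ⊥-elim (m≡1+n⇒n≢1+m i≡1+j (≡.sym 1+i≡j))
  ... | no _    | yes i≡1+j | no _      = begin
    θ (toℕ i) * β (toℕ j) - θ (toℕ j) * β (toℕ j)
      ≈⟨ +-congʳ (*-congʳ (reflexive (≡.cong θ i≡1+j))) ⟩
    θ (suc (toℕ j)) * β (toℕ j) - θ (toℕ j) * β (toℕ j)
      ≈⟨ solve 4 (λ h N J B → (h :* N :- (:1 :+ J)) :* B :- (h :* N :- J) :* B := :- B) refl half (ι n) (ι (toℕ j)) (β (toℕ j)) ⟩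
    - β (toℕ j) ∎
  ... | no _    | no _      | yes 1+i≡j = begin
    θ (toℕ i) * γ (toℕ j) - θ (toℕ j) * γ (toℕ j)
      ≈⟨ +-congˡ (-‿cong (*-congʳ (reflexive (≡.cong θ (≡.sym 1+i≡j))))) ⟩
    θ (toℕ i) * γ (toℕ j) - θ (suc (toℕ i)) * γ (toℕ j)
      ≈⟨ solve 4 (λ h N I G → (h :* N :- I) :* G :- (h :* N :- (:1 :+ I)) :* G := G) refl half (ι n) (ι (toℕ i)) (γ (toℕ j)) ⟩
    γ (toℕ j) ∎
  ... | no _    | no _      | no _      = solve 2 (λ a b → a :* :0 :- b :* :0 := :0) refl (θ (toℕ i)) (θ (toℕ j))

  Aop-cong : ∀ {x y} → x ≋ y → Aop x ≋ Aop y
  Aop-cong x≈y i =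
    +-cong (+-cong (*-congˡ (act-cong Emat x≈y i)) (*-congˡ (act-cong Fmat x≈y i))) (-‿cong (*-congˡ (act-cong Hmat x≈y i)))

  Bop-cong : ∀ {x y} → x ≋ y → Bop x ≋ Bop y
  Bop-cong x≈y i = *-congˡ (act-cong Hmat x≈y i)

  Aop-* : ∀ a x → Aop (λ j → a * x j) ≋ λ i → a * Aop x i
  Aop-* a x i = trans (+-cong (+-cong (*-congˡ (act-* Emat a x i)) (*-congˡ (act-* Fmat a x i))) (-‿cong (*-congˡ (act-* Hmat a x i))))
    (solve 7 (λ e f h a x y z → e :* (a :* x) :+ f :* (a :* y) :- h :* (a :* z) := a :* (e :* x :+ f :* y :- h :* z)) refl
       (half * (1# + ω)) (half * (1# - ω)) (half * ω) a (act Emat x i) (act Fmat x i) (act Hmat x i))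

  [Bop,Aop] : Vect (suc n) → Vect (suc n)
  [Bop,Aop] x i = Bop (Aop x) i - Aop (Bop x) i

  Cop∘G : ∀ x → Cop (G x) ≋ G ([Bop,Aop] x)
  Cop∘G x i = begin
    Aop (Bop (G x)) i - Bop (Aop (G x)) i
      ≈⟨ +-cong (trans (Aop-cong (Bop∘G x) i) (Aop∘G (Aop x) i)) (-‿cong (trans (Bop-cong (Aop∘G x) i) (Bop∘G (Bop x) i))) ⟩
    G (Bop (Aop x)) i - G (Aop (Bop x)) i
      ≈⟨ solve 2 (λ a b → a :- b := :1 :* a :+ (:- :1) :* b) refl _ _ ⟩
    1# * G (Bop (Aop x)) i + (- 1#) * G (Aop (Bop x)) i
      ≈⟨ G-linear 1# (- 1#) _ _ i ⟨
    G (λ j → 1# * Bop (Aop x) j + (- 1#) * Aop (Bop x) j) i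
      ≈⟨ G-cong (λ j → solve 2 (λ a b → :1 :* a :+ (:- :1) :* b := a :- b) refl _ _) i ⟩
    G ([Bop,Aop] x) i ∎

  [Bop,Aop]-δ : ∀ j → [Bop,Aop] (δ j) ≋ λ i → TC i j
  [Bop,Aop]-δ j i = begin
    Bop (Aop (δ j)) i - Aop (Bop (δ j)) i
      ≈⟨ +-cong (trans (Bop-diagonal (Aop (δ j)) i) (*-congˡ (Aop-δ j i)))
                (-‿cong (trans (Aop-cong (λ k → trans (Bop-δ j k) (DA≈θ*δ k j)) i)
                               (trans (Aop-* (θ (toℕ j)) (δ j) i) (*-congˡ (Aop-δ j i))))) ⟩
    θ (toℕ i) * TB i j - θ (toℕ j) * TB i j
      ≈⟨ TC-entry i j ⟩
    TC i j ∎

  open LinearMap G G-cong G-linear using (image-represents)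

  eigenbasis : Σ (Fin (suc n) → Vect (suc n)) (λ u →
    IsBasis u × Represents u Aop DA × Represents u Bop TB × Represents u Cop TC)
  eigenbasis = (λ j → G (δ j))
             , image-isBasis G G⁻¹ G-cong G⁻¹-cong G-linear G⁻¹-linear G⁻¹∘G G∘G⁻¹
             , image-represents Bop Aop DA Aop∘G Bop-δ
             , image-represents Aop Bop TB Bop∘G Aop-δ
             , image-represents [Bop,Aop] Cop TC Cop∘G [Bop,Aop]-δ

lemma2p4 : ∀ {c ℓ : Level} (R : CommutativeRing c ℓ) (F : Over.IsCharZeroField R)
    (ω : CommutativeRing.Carrier R) →
    ¬ (CommutativeRing._≈_ R (CommutativeRing._*_ R ω ω) (CommutativeRing.1# R)) →
    (n : ℕ) →
    let open Over R in
    let open Over.Field R F in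
    let open Over.Field.Module R F n in
    let open Over.Field.Module.Zeta R F n ω in
    Σ (Fin (suc n) → Vect (suc n)) (λ u →
    IsBasis u × Represents u Aop DA × Represents u Bop TB × Represents u Cop TC)
lemma2p4 R F ω ω²≉1 n = Representation.eigenbasis R F ω ω²≉1 n
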